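{- Let $n\ge 3$ be an integer and let $D_n$ be the least common multiple of $1,2,\ldots,n$. Then $$\mathrm{pp}(n)=\sum_{(\ell_1,\ldots,\ell_n)\in\mathbf A_n}\ \prod_{s=2}^{n}\ \sum_{\substack{i_s,j_s\ge 0\\ \frac{i_sD_n}{s}+j_s=\ell_s}}(-1)^{i_s}\binom{s}{i_s}\binom{j_s+s-1}{j_s},$$ where $\mathbf A_n=\{(\ell_1,\ldots,\ell_n)\in\mathbb N^n:\ \ell_1+2\ell_2+\cdots+n\ell_n=n\}$ and the innermost sum runs over pairs of nonnegative integers $(i_s,j_s)$ with $\frac{i_sD_n}{s}+j_s=\ell_s$.
   Context: $\mathbb N=\{0,1,2,\ldots\}$. A plane partition of $n$ is an array $(n_{ij})_{i,j\in\{1,\ldots,n\}}$ of nonnegative integers with $\sum_{i,j}n_{ij}=n$ and $n_{ij}\ge n_{i'j'}$ whenever $i\le i'$ and $j\le j'$; $\mathrm{pp}(n)$ denotes the number of plane partitions of $n$. -}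

module Defs where

open import Data.Nat as ℕ using (ℕ; zero; suc; _∸_; _≤?_)
open import Data.Nat.DivMod using (_/_)
open import Data.Nat.LCM using (lcm)
open import Data.Nat.Combinatorics using (_C_)
open import Data.Integer as ℤ using (ℤ; +_)
open import Data.Fin as Fin using (Fin; toℕ)
open import Data.Vec as Vec using (Vec; []; _∷_; lookup)
open import Data.List as List using (List; upTo; map; foldr)
open import Data.Product using (_×_)
open import Relation.Binary.PropositionalEquality using (_≡_)
open import Relation.Nullary using (yes; no)

D : ℕ → ℕ
D zero    = 1
D (suc n) = lcm (suc n) (D n)

-- An n × n array (a i j), i, j ∈ {1..n} (0-indexed via Fin n)
Array : ℕ → Set
Array n = Vec (Vec ℕ n) n

entry : ∀ {n} → Array n → Fin n → Fin n → ℕ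
entry a i j = lookup (lookup a i) j

IsPlanePartition : (n : ℕ) → Array n → Set
IsPlanePartition n a =
  (Vec.sum (Vec.map Vec.sum a) ≡ n) ×
  (∀ (i i' j j' : Fin n) → i Fin.≤ i' → j Fin.≤ j' → entry a i' j' ℕ.≤ entry a i j)

-- ℓ = (ℓ₁,…,ℓₙ) (ℓ_s = lookup ℓ (s-1)); weighted sum ℓ₁ + 2ℓ₂ + ⋯ + nℓₙ
weightedSum : ∀ {n} → Vec ℕ n → ℕ
weightedSum {n} ℓ = Vec.sum (Vec.tabulate (λ (k : Fin n) → suc (toℕ k) ℕ.* lookup ℓ k))

InA : (n : ℕ) → Vec ℕ n → Set
InA n ℓ = weightedSum ℓ ≡ n

sumℤ : List ℤ → ℤ
sumℤ = foldr ℤ._+_ (+ 0)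

-- inner sum for given Dn, s and ℓ_s:
--   Σ_{i,j ≥ 0, i·(Dn/s) + j = ℓ_s} (-1)^i C(s,i) C(j+s-1,j).
-- Since Dn/s ≥ 1, i ranges within 0..ℓ_s and j = ℓ_s ∸ i·(Dn/s) is determined.
innerSum : (Dn s ℓs : ℕ) → ℤ
innerSum Dn zero ℓs = + 0   -- never used (s ≥ 2)
innerSum Dn (suc s') ℓs = sumℤ (map term (upTo (suc ℓs)))
  where
  s = suc s'
  q = Dn / s
  term : ℕ → ℤ
  term i with i ℕ.* q ≤? ℓs
  ... | yes _ = let j = ℓs ∸ i ℕ.* q in
                (ℤ.- (+ 1)) ℤ.^ i ℤ.* (+ (s C i)) ℤ.* (+ ((j ℕ.+ s ∸ 1) C j))
  ... | no _  = + 0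

prodFrom : (Dn start : ℕ) → ∀ {k} → Vec ℕ k → ℤ
prodFrom Dn start []       = + 1
prodFrom Dn start (x ∷ xs) = innerSum Dn start x ℤ.* prodFrom Dn (suc start) xs

summand : (n : ℕ) → Vec ℕ n → ℤ
summand n []       = + 1
summand n (_ ∷ ℓ') = prodFrom (D n) 2 ℓ'

-- For n ≥ 3 we have D n > n, so every inner sum keeps only its i = 0 term, and the right-hand
-- side becomes the sum over ℓ ∈ 𝐀ₙ of ∏ₛ C(ℓₛ + s - 1, ℓₛ): the coefficient of qⁿ in
-- ∏_{s ≤ n} (1 - qˢ)⁻ˢ, so the statement is MacMahon's formula in degree n.
--
-- MacMahon's formula is proved bijectively, following Okounkov and Reshetikhin. A plane
-- partition in the n × n box is the sequence of its diagonal slices, which interlace upwards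
-- from 0 to the main diagonal and downwards back to 0: a walk with n up-steps and n
-- down-steps whose weighted increments add up to its size. The local rule of RSK growth
-- diagrams exchanges an up-step followed by a down-step for a down-step followed by an
-- up-step plus one free part, which is the relation Γ₊(x) Γ₋(y) = (1 - xy)⁻¹ Γ₋(y) Γ₊(x).
-- Moving all up-steps past all down-steps leaves a walk that stays at 0 and one free part
-- a + b for each 1 ≤ a ≤ n, 0 ≤ b < n. Exactly s of these equal s ≤ n, and stars and bars turns them into the product of binomial coefficients.

module Submission where

open import Data.Nat using (ℕ)

module Sums where

  open import Data.Nat using (ℕ; suc; _+_; _*_; _<_; _≟_; s≤s; z≤n)
  open import Data.Nat.Properties
  open import Algebra.Properties.CommutativeSemigroup +-commutativeSemigroup using (interchange; x∙yz≈y∙xz)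
  open import Data.Nat.ListAction using (sum)
  open import Data.Nat.ListAction.Properties using (sum-++; sum-↭)
  open import Data.List using (List; []; _∷_; [_]; _++_; map; filter; length; cartesianProductWith)
  open import Data.List.Properties using (map-++; map-∘; map-id-local)
  open import Data.List.Membership.Propositional using (_∈_)
  open import Data.List.Membership.Propositional.Properties
    using (∈-map⁺; ∈-map⁻; ∈-filter⁺; ∈-filter⁻; ∈-∃++)
  open import Data.List.Membership.Propositional.Properties.WithK using (unique∧set⇒bag)
  open import Data.List.Relation.Unary.All using (tabulate)
  open import Data.List.Relation.Unary.All.Properties using (All¬⇒¬Any)
  open import Data.List.Relation.Unary.Any using (here; there)
  open import Data.List.Relation.Unary.Unique.Propositional using (Unique; _∷_)
  open import Data.List.Relation.Unary.Unique.Propositional.Properties as Unique using ()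
  open import Data.List.Relation.Binary.BagAndSetEquality using (∼bag⇒↭)
  open import Data.List.Relation.Binary.Permutation.Propositional using (_↭_; ↭-refl; ↭-trans; ↭-sym; prep)
  import Data.List.Relation.Binary.Permutation.Propositional.Properties as ↭
  open import Data.Product using (_×_; _,_; proj₂)
  open import Function using (_∘_; mk⇔)
  open import Relation.Nullary using (Dec; yes; no; ¬_; contradiction)
  open import Relation.Nullary.Decidable using (_×-dec_)
  open import Relation.Binary.PropositionalEquality using (_≡_; _≢_; refl; sym; trans; cong; cong₂; subst; module ≡-Reasoning)

  private variable
    A B P Q : Set

  ∑ : List A → (A → ℕ) → ℕ
  ∑ xs f = sum (map f xs)

  infixr 5 ∑
  syntax ∑ xs (λ x → e) = ∑[ x ← xs ] e

  [_]·_ : Dec P → ℕ → ℕ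
  [ yes _ ]· m = m
  [ no _  ]· m = 0

  infixr 5 [_]·_

  ∑-cong-local : (xs : List A) {f g : A → ℕ} → (∀ {x} → x ∈ xs → f x ≡ g x) → ∑ xs f ≡ ∑ xs g
  ∑-cong-local []       f≡g = refl
  ∑-cong-local (x ∷ xs) f≡g = cong₂ _+_ (f≡g (here refl)) (∑-cong-local xs (f≡g ∘ there))

  ∑-cong : (xs : List A) {f g : A → ℕ} → (∀ x → f x ≡ g x) → ∑ xs f ≡ ∑ xs g
  ∑-cong xs f≡g = ∑-cong-local xs (λ {x} _ → f≡g x)

  ∑-zero : (xs : List A) {f : A → ℕ} → (∀ {x} → x ∈ xs → f x ≡ 0) → ∑ xs f ≡ 0
  ∑-zero []       f≡0 = refl
  ∑-zero (x ∷ xs) f≡0 = cong₂ _+_ (f≡0 (here refl)) (∑-zero xs (f≡0 ∘ there))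

  ∑-+ : (xs : List A) (f g : A → ℕ) → ∑[ x ← xs ] (f x + g x) ≡ ∑ xs f + ∑ xs g
  ∑-+ []       f g = refl
  ∑-+ (x ∷ xs) f g = trans (cong (f x + g x +_) (∑-+ xs f g)) (interchange (f x) (g x) (∑ xs f) (∑ xs g))

  ∑-comm : (xs : List A) (ys : List B) (f : A → B → ℕ) →
           ∑[ x ← xs ] ∑[ y ← ys ] f x y ≡ ∑[ y ← ys ] ∑[ x ← xs ] f x y
  ∑-comm []       ys f = sym (∑-zero ys (λ _ → refl))
  ∑-comm (x ∷ xs) ys f =
    trans (cong (∑ ys (f x) +_) (∑-comm xs ys f)) (sym (∑-+ ys (f x) (λ y → ∑[ x ← xs ] f x y)))

  ∑-*ˡ : (c : ℕ) (xs : List A) (f : A → ℕ) → c * ∑ xs f ≡ ∑[ x ← xs ] (c * f x)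
  ∑-*ˡ c []       f = *-zeroʳ c
  ∑-*ˡ c (x ∷ xs) f = trans (*-distribˡ-+ c (f x) (∑ xs f)) (cong (c * f x +_) (∑-*ˡ c xs f))

  ∑-*ʳ : (c : ℕ) (xs : List A) (f : A → ℕ) → ∑ xs f * c ≡ ∑[ x ← xs ] (f x * c)
  ∑-*ʳ c xs f = trans (*-comm (∑ xs f) c)
    (trans (∑-*ˡ c xs f) (∑-cong xs (λ x → *-comm c (f x))))

  ∑-++ : (xs ys : List A) (f : A → ℕ) → ∑ (xs ++ ys) f ≡ ∑ xs f + ∑ ys f
  ∑-++ xs ys f = trans (cong sum (map-++ f xs ys)) (sum-++ (map f xs) (map f ys))

  ∑-map : (g : A → B) (xs : List A) (f : B → ℕ) → ∑ (map g xs) f ≡ ∑ xs (f ∘ g)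
  ∑-map g xs f = cong sum (sym (map-∘ xs))

  ∑-cartesianProductWith : {C : Set} (g : A → B → C) (xs : List A) (ys : List B) (f : C → ℕ) →
                           ∑ (cartesianProductWith g xs ys) f ≡ ∑[ x ← xs ] ∑[ y ← ys ] f (g x y)
  ∑-cartesianProductWith g []       ys f = refl
  ∑-cartesianProductWith g (x ∷ xs) ys f = trans (∑-++ (map (g x) ys) (cartesianProductWith g xs ys) f)
    (cong₂ _+_ (∑-map (g x) ys f) (∑-cartesianProductWith g xs ys f))

  ∑-↭ : {xs ys : List A} (f : A → ℕ) → xs ↭ ys → ∑ xs f ≡ ∑ ys f
  ∑-↭ f xs↭ys = sum-↭ (↭.map⁺ f xs↭ys)

  length≡∑1 : (xs : List A) → length xs ≡ ∑[ x ← xs ] 1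
  length≡∑1 []       = refl
  length≡∑1 (x ∷ xs) = cong suc (length≡∑1 xs)

  ∑-filter : {P : A → Set} (P? : ∀ x → Dec (P x)) (xs : List A) (f : A → ℕ) →
             ∑ (filter P? xs) f ≡ ∑[ x ← xs ] [ P? x ]· f x
  ∑-filter P? []       f = refl
  ∑-filter P? (x ∷ xs) f with P? x
  ... | yes _ = cong (f x +_) (∑-filter P? xs f)
  ... | no  _ = ∑-filter P? xs f

  ∑-single : (xs : List A) (f : A → ℕ) {x₀ : A} → Unique xs → x₀ ∈ xs →
             (∀ {x} → x ∈ xs → x ≢ x₀ → f x ≡ 0) → ∑ xs f ≡ f x₀
  ∑-single (x ∷ xs) f (x∉xs ∷ _) (here refl) f≡0 =
    trans (cong (f x +_) (∑-zero xs (λ y∈xs → f≡0 (there y∈xs) (λ { refl → All¬⇒¬Any x∉xs y∈xs }))))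
          (+-identityʳ (f x))
  ∑-single (x ∷ xs) f (x∉xs ∷ u) (there x₀∈xs) f≡0 =
    trans (cong (_+ ∑ xs f) (f≡0 (here refl) (λ { refl → All¬⇒¬Any x∉xs x₀∈xs })))
          (∑-single xs f u x₀∈xs (f≡0 ∘ there))

  unique-map-leftInverse : {xs : List A} (φ : A → B) (ψ : B → A) →
                          (∀ {x} → x ∈ xs → ψ (φ x) ≡ x) → Unique xs → Unique (map φ xs)
  unique-map-leftInverse {xs = xs} φ ψ ψφ≡id u =
    Unique.map⁻ {f = ψ} (subst Unique (sym (trans (sym (map-∘ xs)) (map-id-local (tabulate ψφ≡id)))) u)

  ∑-reindex : {P : A → Set} {Q : B → Set} (P? : ∀ x → Dec (P x)) (Q? : ∀ y → Dec (Q y))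
              {xs : List A} {ys : List B} → Unique xs → Unique ys → (φ : A → B) (ψ : B → A) →
              (∀ {x} → x ∈ xs → P x → (φ x ∈ ys × Q (φ x)) × ψ (φ x) ≡ x) →
              (∀ {y} → y ∈ ys → Q y → (ψ y ∈ xs × P (ψ y)) × φ (ψ y) ≡ y) →
              (g : B → ℕ) → ∑[ x ← xs ] [ P? x ]· g (φ x) ≡ ∑[ y ← ys ] [ Q? y ]· g y
  ∑-reindex P? Q? {xs} {ys} uxs uys φ ψ to from g = begin
    ∑[ x ← xs ] [ P? x ]· g (φ x) ≡⟨ ∑-filter P? xs (g ∘ φ) ⟨
    ∑ (filter P? xs) (g ∘ φ)      ≡⟨ ∑-map φ (filter P? xs) g ⟨
    ∑ (map φ (filter P? xs)) g    ≡⟨ ∑-↭ g (∼bag⇒↭ (unique∧set⇒bag unique-image (Unique.filter⁺ Q? uys) (mk⇔ image⊆ image⊇))) ⟩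
    ∑ (filter Q? ys) g            ≡⟨ ∑-filter Q? ys g ⟩
    ∑[ y ← ys ] [ Q? y ]· g y     ∎
    where
    open ≡-Reasoning
    unique-image : Unique (map φ (filter P? xs))
    unique-image = unique-map-leftInverse φ ψ
      (λ x∈ → let x∈xs , px = ∈-filter⁻ P? x∈ in proj₂ (to x∈xs px)) (Unique.filter⁺ P? uxs)
    image⊆ : ∀ {y} → y ∈ map φ (filter P? xs) → y ∈ filter Q? ys
    image⊆ y∈ with x , x∈ , refl ← ∈-map⁻ φ y∈ =
      let x∈xs , px = ∈-filter⁻ P? x∈ ; (φx∈ys , qφx) , _ = to x∈xs px in ∈-filter⁺ Q? φx∈ys qφx
    image⊇ : ∀ {y} → y ∈ filter Q? ys → y ∈ map φ (filter P? xs)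
    image⊇ y∈ with y∈ys , qy ← ∈-filter⁻ Q? y∈ with (ψy∈xs , pψy) , φψy≡y ← from y∈ys qy =
      subst (_∈ map φ (filter P? xs)) φψy≡y (∈-map⁺ φ (∈-filter⁺ P? ψy∈xs pψy))

  []·-zero : (d : Dec P) → [ d ]· 0 ≡ 0
  []·-zero (yes _) = refl
  []·-zero (no _)  = refl

  []·-yes : (d : Dec P) → P → (m : ℕ) → [ d ]· m ≡ m
  []·-yes (yes _) p m = refl
  []·-yes (no ¬p) p m = contradiction p ¬p

  []·-no : (d : Dec P) → ¬ P → (m : ℕ) → [ d ]· m ≡ 0
  []·-no (yes p) ¬p m = contradiction p ¬p
  []·-no (no _)  ¬p m = refl

  []·-cong : (d : Dec P) {m m′ : ℕ} → (P → m ≡ m′) → [ d ]· m ≡ [ d ]· m′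
  []·-cong (yes p) m≡m′ = m≡m′ p
  []·-cong (no _)  m≡m′ = refl

  []·-∑ : (d : Dec P) (xs : List A) (f : A → ℕ) → [ d ]· ∑ xs f ≡ ∑[ x ← xs ] [ d ]· f x
  []·-∑ (yes _) xs f = refl
  []·-∑ (no _)  xs f = sym (∑-zero xs (λ _ → refl))

  []·-× : (d : Dec P) (e : Dec Q) (m : ℕ) → [ d ]· [ e ]· m ≡ [ d ×-dec e ]· m
  []·-× (yes _) (yes _) m = refl
  []·-× (yes _) (no _)  m = refl
  []·-× (no _)  e       m = refl

  []·-restrict : (d : Dec P) (e : Dec Q) (m : ℕ) → (P → ¬ Q → m ≡ 0) → [ d ]· m ≡ [ d ×-dec e ]· m
  []·-restrict (yes p) (yes q) m m≡0 = refl
  []·-restrict (yes p) (no ¬q) m m≡0 = m≡0 p ¬q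
  []·-restrict (no _)  e       m m≡0 = refl

  *-[]· : (d : Dec P) (c m : ℕ) → c * ([ d ]· m) ≡ [ d ]· c * m
  *-[]· (yes _) c m = refl
  *-[]· (no _)  c m = *-zeroʳ c

  []·-*ʳ : (d : Dec P) (c m : ℕ) → [ d ]· c * m ≡ ([ d ]· c) * m
  []·-*ʳ (yes _) c m = refl
  []·-*ʳ (no _)  c m = refl

  occurrences : ℕ → List ℕ → ℕ
  occurrences x xs = ∑[ y ← xs ] [ y ≟ x ]· 1

  occurrences⇒∈ : ∀ {x} xs → 0 < occurrences x xs → x ∈ xs
  occurrences⇒∈ {x} (y ∷ ys) 0<occ with y ≟ x
  ... | yes refl = here refl
  ... | no _     = there (occurrences⇒∈ ys 0<occ)

  0<occurrences-∷ : ∀ x xs → 0 < occurrences x (x ∷ xs)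
  0<occurrences-∷ x xs rewrite []·-yes (x ≟ x) refl 1 = s≤s z≤n

  ↭-occurrences : ∀ xs ys → (∀ x → occurrences x xs ≡ occurrences x ys) → xs ↭ ys
  ↭-occurrences []       []       _   = ↭-refl
  ↭-occurrences []       (y ∷ ys) occ≡ = contradiction (trans (occ≡ y) (cong (_+ occurrences y ys) ([]·-yes (y ≟ y) refl 1))) 0≢1+n
  ↭-occurrences (x ∷ xs) ys       occ≡
    with us , vs , refl ← ∈-∃++ (occurrences⇒∈ ys (subst (0 <_) (occ≡ x) (0<occurrences-∷ x xs))) =
    ↭-trans (prep x (↭-occurrences xs (us ++ vs) occ≡′)) (↭-sym (↭.shift x us vs))
    where
    occ≡′ : ∀ z → occurrences z xs ≡ occurrences z (us ++ vs)
    occ≡′ z = +-cancelˡ-≡ ([ x ≟ z ]· 1) _ _ (begin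
      ([ x ≟ z ]· 1) + occurrences z xs                        ≡⟨ occ≡ z ⟩
      occurrences z (us ++ [ x ] ++ vs)                        ≡⟨ ∑-++ us ([ x ] ++ vs) _ ⟩
      occurrences z us + (([ x ≟ z ]· 1) + occurrences z vs)   ≡⟨ x∙yz≈y∙xz (occurrences z us) ([ x ≟ z ]· 1) (occurrences z vs) ⟩
      ([ x ≟ z ]· 1) + (occurrences z us + occurrences z vs)   ≡⟨ cong (([ x ≟ z ]· 1) +_) (∑-++ us vs _) ⟨
      ([ x ≟ z ]· 1) + occurrences z (us ++ vs)                ∎)
      where open ≡-Reasoning

  []·≡*[]·1 : (d : Dec P) (m : ℕ) → [ d ]· m ≡ m * ([ d ]· 1)
  []·≡*[]·1 (yes _) m = sym (*-identityʳ m)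
  []·≡*[]·1 (no _)  m = sym (*-zeroʳ m)

module BoundedVectors where

  open import Data.Nat using (ℕ; zero; suc; _≤_; s≤s)
  open import Data.Nat.Properties using (≤-trans; ≤-pred; m≤m+n; m≤n+m)
  open import Data.List using (List; []; _∷_; [_]; upTo; cartesianProductWith)
  open import Data.List.Membership.Propositional using (_∈_)
  open import Data.List.Membership.Propositional.Properties
    using (∈-upTo⁺; ∈-upTo⁻; ∈-cartesianProductWith⁺; ∈-cartesianProductWith⁻)
  open import Data.List.Relation.Unary.Any using (here)
  import Data.List.Relation.Unary.All as ListAll
  open import Data.List.Relation.Unary.Unique.Propositional using (Unique; []; _∷_)
  open import Data.List.Relation.Unary.Unique.Propositional.Properties using (upTo⁺; cartesianProductWith⁺)
  open import Data.Vec using (Vec; []; _∷_; sum)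
  open import Data.Vec.Properties using (∷-injective)
  open import Data.Vec.Relation.Unary.All as All using (All; []; _∷_)
  open import Data.Product using (_,_)
  open import Function using (_∘_)
  open import Relation.Binary.PropositionalEquality using (refl)

  private variable
    A : Set

  vecsOver : List A → (m : ℕ) → List (Vec A m)
  vecsOver xs zero    = [ [] ]
  vecsOver xs (suc m) = cartesianProductWith _∷_ xs (vecsOver xs m)

  vecsOver-unique : {xs : List A} → Unique xs → ∀ m → Unique (vecsOver xs m)
  vecsOver-unique u zero    = ListAll.[] ∷ []
  vecsOver-unique u (suc m) = cartesianProductWith⁺ _∷_ ∷-injective u (vecsOver-unique u m)

  ∈-vecsOver⁺ : ∀ {xs : List A} {m} {v : Vec A m} → All (_∈ xs) v → v ∈ vecsOver xs m
  ∈-vecsOver⁺ []        = here refl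
  ∈-vecsOver⁺ (x∈ ∷ v∈) = ∈-cartesianProductWith⁺ _∷_ x∈ (∈-vecsOver⁺ v∈)

  ∈-vecsOver⁻ : ∀ {xs : List A} {m} {v : Vec A m} → v ∈ vecsOver xs m → All (_∈ xs) v
  ∈-vecsOver⁻ {m = zero}  {[]} _ = []
  ∈-vecsOver⁻ {xs = xs} {suc m} v∈ with _ , _ , x∈ , v∈′ , refl ← ∈-cartesianProductWith⁻ _∷_ xs (vecsOver xs m) v∈ =
    x∈ ∷ ∈-vecsOver⁻ v∈′

  vecsUpTo : ℕ → (m : ℕ) → List (Vec ℕ m)
  vecsUpTo N = vecsOver (upTo (suc N))

  vecsUpTo-unique : ∀ N m → Unique (vecsUpTo N m)
  vecsUpTo-unique N = vecsOver-unique (upTo⁺ (suc N))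

  ∈-vecsUpTo⁺ : ∀ {N m} {v : Vec ℕ m} → All (_≤ N) v → v ∈ vecsUpTo N m
  ∈-vecsUpTo⁺ = ∈-vecsOver⁺ ∘ All.map (∈-upTo⁺ ∘ s≤s)

  ∈-vecsUpTo⁻ : ∀ {N m} {v : Vec ℕ m} → v ∈ vecsUpTo N m → All (_≤ N) v
  ∈-vecsUpTo⁻ = All.map (≤-pred ∘ ∈-upTo⁻) ∘ ∈-vecsOver⁻

  sum≤⇒All≤ : ∀ {N m} (v : Vec ℕ m) → sum v ≤ N → All (_≤ N) v
  sum≤⇒All≤ []      _     = []
  sum≤⇒All≤ (x ∷ v) Σv≤N = ≤-trans (m≤m+n x (sum v)) Σv≤N ∷ sum≤⇒All≤ v (≤-trans (m≤n+m (sum v) x) Σv≤N)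

module Interlacing where

  open import Data.Nat
  open import Data.Nat.Properties
  open import Data.Nat.Solver using (module +-*-Solver)
  open import Data.Vec using (Vec; []; _∷_; sum; last; replicate)
  open import Data.Vec.Relation.Unary.All using (All; []; _∷_)
  open import Data.Product using (_×_; _,_; proj₁; proj₂)
  open import Data.Unit using (⊤; tt)
  open import Relation.Nullary using (Dec; yes; contradiction)
  open import Relation.Nullary.Decidable using (_×-dec_)
  open import Relation.Binary.PropositionalEquality
  open +-*-Solver using (solve; _:+_; _:=_)

  private variable
    m N : ℕ

  head₀ : Vec ℕ m → ℕ
  head₀ []      = 0
  head₀ (x ∷ _) = x

  infix 4 _≺_ _≺?_

  -- μ ≺ α says that the parts interlace, α₀ ≥ μ₀ ≥ α₁ ≥ μ₁ ≥ ⋯, i.e. α / μ is a horizontal strip.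
  _≺_ : Vec ℕ m → Vec ℕ m → Set
  []      ≺ []      = ⊤
  (x ∷ μ) ≺ (y ∷ α) = x ≤ y × head₀ α ≤ x × μ ≺ α

  _≺?_ : (μ α : Vec ℕ m) → Dec (μ ≺ α)
  []      ≺? []      = yes tt
  (x ∷ μ) ≺? (y ∷ α) = x ≤? y ×-dec head₀ α ≤? x ×-dec μ ≺? α

  ≺-head : {μ α : Vec ℕ m} → μ ≺ α → head₀ μ ≤ head₀ α
  ≺-head {μ = []}    {[]}    _         = z≤n
  ≺-head {μ = _ ∷ _} {_ ∷ _} (x≤y , _) = x≤y

  head₀-All≤ : {α : Vec ℕ m} → All (_≤ N) α → head₀ α ≤ N
  head₀-All≤ []        = z≤n
  head₀-All≤ (a≤N ∷ _) = a≤N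

  ≺-sum : {μ α : Vec ℕ m} → μ ≺ α → sum μ ≤ sum α
  ≺-sum {μ = []}    {[]}    _               = z≤n
  ≺-sum {μ = _ ∷ _} {_ ∷ _} (x≤y , _ , μ≺α) = +-mono-≤ x≤y (≺-sum μ≺α)

  ≺-All≤ : {μ α : Vec ℕ m} → μ ≺ α → All (_≤ N) α → All (_≤ N) μ
  ≺-All≤ {μ = []}    {[]}    _               []          = []
  ≺-All≤ {μ = _ ∷ _} {_ ∷ _} (x≤y , _ , μ≺α) (y≤N ∷ α≤N) = ≤-trans x≤y y≤N ∷ ≺-All≤ μ≺α α≤N

  0≺0 : replicate m 0 ≺ replicate m 0
  0≺0 {zero}        = tt
  0≺0 {suc zero}    = z≤n , z≤n , tt
  0≺0 {suc (suc m)} = z≤n , z≤n , 0≺0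

  ≺0⇒≡0 : (μ : Vec ℕ m) → μ ≺ replicate m 0 → μ ≡ replicate m 0
  ≺0⇒≡0 []      _               = refl
  ≺0⇒≡0 (x ∷ μ) (z≤n , _ , μ≺0) = cong (0 ∷_) (≺0⇒≡0 μ μ≺0)

  sum-replicate-0 : ∀ m → sum (replicate m 0) ≡ 0
  sum-replicate-0 zero    = refl
  sum-replicate-0 (suc m) = sum-replicate-0 m

  ≺-last≤head : {μ α : Vec ℕ (suc m)} → μ ≺ α → last α ≤ head₀ α
  ≺-last≤head {μ = _ ∷ []}    {_ ∷ []}    _                   = ≤-refl
  ≺-last≤head {μ = _ ∷ _ ∷ _} {_ ∷ _ ∷ _} (x≤y , y′≤x , μ≺α) = ≤-trans (≺-last≤head μ≺α) (≤-trans y′≤x x≤y)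

  ≺-*last≤sum : {μ α : Vec ℕ (suc m)} → μ ≺ α → suc m * last α ≤ sum α
  ≺-*last≤sum {μ = _ ∷ []}    {_ ∷ []}    _                   = ≤-refl
  ≺-*last≤sum {μ = _ ∷ _ ∷ _} {_ ∷ _ ∷ _} (x≤y , y′≤x , μ≺α) =
    +-mono-≤ (≤-trans (≺-last≤head μ≺α) (≤-trans y′≤x x≤y)) (≺-*last≤sum μ≺α)

  ≺-last≡0 : {μ α : Vec ℕ (suc m)} → μ ≺ α → sum α ≤ m → last α ≡ 0
  ≺-last≡0 {m} {α = α} μ≺α Σα≤m = [1+m]*x≤m⇒x≡0 (last α) (≤-trans (≺-*last≤sum μ≺α) Σα≤m)
    where
    [1+m]*x≤m⇒x≡0 : ∀ x → suc m * x ≤ m → x ≡ 0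
    [1+m]*x≤m⇒x≡0 zero    _  = refl
    [1+m]*x≤m⇒x≡0 (suc x) le = contradiction (≤-trans (m≤m*n (suc m) (suc x)) le) (n≮n m)

  -- The local rule of RSK growth diagrams: part i of κ = grow k α ν μ is max(αᵢ, νᵢ) plus a
  -- carry, which is k for the first part and min(αᵢ, νᵢ) - μᵢ for part i + 1; shrink undoes
  -- it from the last part upwards.
  grow : ℕ → (α ν μ : Vec ℕ m) → Vec ℕ m
  grow k []      []      []      = []
  grow k (a ∷ α) (v ∷ ν) (x ∷ μ) = (a ⊔ v) + k ∷ grow ((a ⊓ v) ∸ x) α ν μ

  overflow : ℕ → (α ν μ : Vec ℕ m) → ℕ
  overflow k []      []      []      = k
  overflow k (a ∷ α) (v ∷ ν) (x ∷ μ) = overflow ((a ⊓ v) ∸ x) α ν μ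

  shrink : (κ α ν : Vec ℕ m) → ℕ × Vec ℕ m
  shrink []      []      []      = 0 , []
  shrink (c ∷ κ) (a ∷ α) (v ∷ ν) =
    c ∸ (a ⊔ v) , ((a ⊓ v) ∸ proj₁ (shrink κ α ν)) ∷ proj₂ (shrink κ α ν)

  overflow≡0 : (k : ℕ) (α ν μ : Vec ℕ (suc m)) → last α ≡ 0 → overflow k α ν μ ≡ 0
  overflow≡0 k (a ∷ [])        (v ∷ []) (x ∷ []) refl = 0∸n≡0 x
  overflow≡0 k (a ∷ α@(_ ∷ _)) (v ∷ ν)  (x ∷ μ)  α≡0  = overflow≡0 _ α ν μ α≡0

  head-grow≤ : (k : ℕ) (α ν μ : Vec ℕ m) → head₀ (grow k α ν μ) ≤ (head₀ α ⊔ head₀ ν) + k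
  head-grow≤ k []      []      []      = z≤n
  head-grow≤ k (a ∷ α) (v ∷ ν) (x ∷ μ) = ≤-refl

  proj₁-shrink : (κ α ν : Vec ℕ m) → proj₁ (shrink κ α ν) ≡ head₀ κ ∸ (head₀ α ⊔ head₀ ν)
  proj₁-shrink []      []      []      = refl
  proj₁-shrink (c ∷ κ) (a ∷ α) (v ∷ ν) = refl

  ≺-grow : (k : ℕ) {α ν μ : Vec ℕ m} → μ ≺ α → μ ≺ ν → α ≺ grow k α ν μ × ν ≺ grow k α ν μ
  ≺-grow k {[]}    {[]}    {[]}    _ _ = tt , tt
  ≺-grow k {a ∷ α} {v ∷ ν} {x ∷ μ} (x≤a , α₀≤x , μ≺α) (x≤v , ν₀≤x , μ≺ν) =
    (≤-trans (m≤m⊔n a v) (m≤m+n _ k) , ≤-trans grow₀≤a⊓v (m⊓n≤m a v) , proj₁ ih) ,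
    (≤-trans (m≤n⊔m a v) (m≤m+n _ k) , ≤-trans grow₀≤a⊓v (m⊓n≤n a v) , proj₂ ih)
    where
    ih = ≺-grow ((a ⊓ v) ∸ x) μ≺α μ≺ν
    grow₀≤a⊓v : head₀ (grow ((a ⊓ v) ∸ x) α ν μ) ≤ a ⊓ v
    grow₀≤a⊓v = ≤-trans (head-grow≤ _ α ν μ)
      (≤-trans (+-monoˡ-≤ _ (⊔-lub α₀≤x ν₀≤x)) (≤-reflexive (m+[n∸m]≡n (⊓-glb x≤a x≤v))))

  shrink-≺ : {κ α ν : Vec ℕ m} → α ≺ κ → ν ≺ κ → proj₂ (shrink κ α ν) ≺ α × proj₂ (shrink κ α ν) ≺ ν
  shrink-≺ {κ = []}    {[]}    {[]}    _ _ = tt , tt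
  shrink-≺ {κ = c ∷ κ} {a ∷ α} {v ∷ ν} (a≤c , κ₀≤a , α≺κ) (v≤c , κ₀≤v , ν≺κ) =
    (≤-trans (m∸n≤m (a ⊓ v) k) (m⊓n≤m a v) , ≤-trans (m≤m⊔n _ _) α₀⊔ν₀≤x , proj₁ ih) ,
    (≤-trans (m∸n≤m (a ⊓ v) k) (m⊓n≤n a v) , ≤-trans (m≤n⊔m _ _) α₀⊔ν₀≤x , proj₂ ih)
    where
    ih = shrink-≺ α≺κ ν≺κ
    k = proj₁ (shrink κ α ν)
    α₀⊔ν₀≤x : head₀ α ⊔ head₀ ν ≤ (a ⊓ v) ∸ k
    α₀⊔ν₀≤x rewrite proj₁-shrink κ α ν =
      ≤-trans (≤-reflexive (sym (m∸[m∸n]≡n α₀⊔ν₀≤κ₀))) (∸-monoˡ-≤ (head₀ κ ∸ (head₀ α ⊔ head₀ ν)) (⊓-glb κ₀≤a κ₀≤v))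
      where α₀⊔ν₀≤κ₀ = ⊔-lub (≺-head α≺κ) (≺-head ν≺κ)

  shrink-grow : (k : ℕ) {α ν μ : Vec ℕ m} → μ ≺ α → μ ≺ ν → overflow k α ν μ ≡ 0 →
                shrink (grow k α ν μ) α ν ≡ (k , μ)
  shrink-grow k {[]}    {[]}    {[]}    _ _ refl = refl
  shrink-grow k {a ∷ α} {v ∷ ν} {x ∷ μ} (x≤a , _ , μ≺α) (x≤v , _ , μ≺ν) overflow≡0
    rewrite shrink-grow ((a ⊓ v) ∸ x) μ≺α μ≺ν overflow≡0 =
    cong₂ _,_ (m+n∸m≡n (a ⊔ v) k) (cong (_∷ μ) (m∸[m∸n]≡n (⊓-glb x≤a x≤v)))

  grow-shrink : {κ α ν : Vec ℕ m} → α ≺ κ → ν ≺ κ →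
                grow (proj₁ (shrink κ α ν)) α ν (proj₂ (shrink κ α ν)) ≡ κ
  grow-shrink {κ = []}    {[]}    {[]}    _ _ = refl
  grow-shrink {κ = c ∷ κ} {a ∷ α} {v ∷ ν} (a≤c , κ₀≤a , α≺κ) (v≤c , κ₀≤v , ν≺κ) =
    cong₂ _∷_ (m+[n∸m]≡n (⊔-lub a≤c v≤c))
      (trans (cong (λ k → grow k α ν (proj₂ (shrink κ α ν))) (m∸[m∸n]≡n k≤a⊓v)) (grow-shrink α≺κ ν≺κ))
    where
    k≤a⊓v : proj₁ (shrink κ α ν) ≤ a ⊓ v
    k≤a⊓v rewrite proj₁-shrink κ α ν = ≤-trans (m∸n≤m (head₀ κ) (head₀ α ⊔ head₀ ν)) (⊓-glb κ₀≤a κ₀≤v)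

  m⊔n+m⊓n≡m+n : ∀ m n → m ⊔ n + m ⊓ n ≡ m + n
  m⊔n+m⊓n≡m+n zero    n       = +-identityʳ n
  m⊔n+m⊓n≡m+n (suc m) zero    = refl
  m⊔n+m⊓n≡m+n (suc m) (suc n) =
    cong suc (trans (+-suc (m ⊔ n) (m ⊓ n)) (trans (cong suc (m⊔n+m⊓n≡m+n m n)) (sym (+-suc m n))))

  sum-grow : (k : ℕ) {α ν μ : Vec ℕ m} → μ ≺ α → μ ≺ ν →
             sum (grow k α ν μ) + sum μ + overflow k α ν μ ≡ sum α + sum ν + k
  sum-grow k {[]}    {[]}    {[]}    _ _ = refl
  sum-grow k {a ∷ α} {v ∷ ν} {x ∷ μ} (x≤a , _ , μ≺α) (x≤v , _ , μ≺ν) = begin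
    (a ⊔ v + k + Σκ) + (x + Σμ) + o          ≡⟨ solve 6 (λ M k Σκ x Σμ o → (M :+ k :+ Σκ) :+ (x :+ Σμ) :+ o
                                                          := M :+ k :+ x :+ (Σκ :+ Σμ :+ o)) refl (a ⊔ v) k Σκ x Σμ o ⟩
    a ⊔ v + k + x + (Σκ + Σμ + o)            ≡⟨ cong (a ⊔ v + k + x +_) (sum-grow c μ≺α μ≺ν) ⟩
    a ⊔ v + k + x + (Σα + Σν + c)            ≡⟨ solve 6 (λ M k x Σα Σν c → M :+ k :+ x :+ (Σα :+ Σν :+ c)
                                                          := M :+ (c :+ x) :+ (Σα :+ Σν :+ k)) refl (a ⊔ v) k x Σα Σν c ⟩
    a ⊔ v + (c + x) + (Σα + Σν + k)          ≡⟨ cong (λ z → a ⊔ v + z + (Σα + Σν + k)) (m∸n+n≡m (⊓-glb x≤a x≤v)) ⟩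
    a ⊔ v + a ⊓ v + (Σα + Σν + k)            ≡⟨ cong (_+ (Σα + Σν + k)) (m⊔n+m⊓n≡m+n a v) ⟩
    a + v + (Σα + Σν + k)                    ≡⟨ solve 5 (λ a v Σα Σν k → a :+ v :+ (Σα :+ Σν :+ k)
                                                          := (a :+ Σα) :+ (v :+ Σν) :+ k) refl a v Σα Σν k ⟩
    (a + Σα) + (v + Σν) + k                  ∎
    where
    open ≡-Reasoning
    c  = (a ⊓ v) ∸ x
    Σκ = sum (grow c α ν μ)
    Σμ = sum μ
    Σα = sum α
    Σν = sum ν
    o  = overflow c α ν μ

  private
    ∸-from-+ : ∀ {K M A V} k → K + M ≡ A + V + k → M ≤ V → K ∸ A ≡ V ∸ M + k
    ∸-from-+ {K} {M} {A} {V} k K+M≡A+V+k M≤V = trans (cong (_∸ A) K≡A+[V∸M+k]) (m+n∸m≡n A (V ∸ M + k))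
      where
      K≡A+[V∸M+k] : K ≡ A + (V ∸ M + k)
      K≡A+[V∸M+k] = +-cancelʳ-≡ M K _ (begin
        K + M                   ≡⟨ K+M≡A+V+k ⟩
        A + V + k               ≡⟨ cong (λ v → A + v + k) (m∸n+n≡m M≤V) ⟨
        A + (V ∸ M + M) + k     ≡⟨ solve 4 (λ A D M k → A :+ (D :+ M) :+ k := A :+ (D :+ k) :+ M) refl A (V ∸ M) M k ⟩
        A + (V ∸ M + k) + M     ∎)
        where open ≡-Reasoning

  sum-grow-exact : (k : ℕ) {α ν μ : Vec ℕ m} → μ ≺ α → μ ≺ ν → overflow k α ν μ ≡ 0 →
                   sum (grow k α ν μ) + sum μ ≡ sum α + sum ν + k
  sum-grow-exact k {α} {ν} {μ} μ≺α μ≺ν o≡0 =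
    trans (sym (+-identityʳ _)) (trans (cong (sum (grow k α ν μ) + sum μ +_) (sym o≡0)) (sum-grow k μ≺α μ≺ν))

  sum-grow∸ˡ : (k : ℕ) {α ν μ : Vec ℕ m} → μ ≺ α → μ ≺ ν → overflow k α ν μ ≡ 0 →
               sum (grow k α ν μ) ∸ sum α ≡ sum ν ∸ sum μ + k
  sum-grow∸ˡ k μ≺α μ≺ν o≡0 = ∸-from-+ k (sum-grow-exact k μ≺α μ≺ν o≡0) (≺-sum μ≺ν)

  sum-grow∸ʳ : (k : ℕ) {α ν μ : Vec ℕ m} → μ ≺ α → μ ≺ ν → overflow k α ν μ ≡ 0 →
               sum (grow k α ν μ) ∸ sum ν ≡ sum α ∸ sum μ + k
  sum-grow∸ʳ k {α} {ν} μ≺α μ≺ν o≡0 =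
    ∸-from-+ k (trans (sum-grow-exact k μ≺α μ≺ν o≡0) (cong (_+ k) (+-comm (sum α) (sum ν)))) (≺-sum μ≺α)

module Binomials where

  open import Data.Nat
  open import Data.Nat.Properties
  open import Data.Nat.Combinatorics using (_C_; k>n⇒nCk≡0; nCk+nC[k+1]≡[n+1]C[k+1])
  open import Data.Vec using (Vec; []; _∷_)
  open import Data.Vec.Relation.Unary.All as All using (All; []; _∷_)
  open import Relation.Nullary using (contradiction)
  open import Relation.Binary.PropositionalEquality

  private variable
    m : ℕ

  multichoose : ℕ → ℕ → ℕ
  multichoose s l = (l + s ∸ 1) C l

  multichoose-0 : ∀ {l} → l ≢ 0 → multichoose 0 l ≡ 0
  multichoose-0 {zero}  l≢0 = contradiction refl l≢0
  multichoose-0 {suc l} _   = k>n⇒nCk≡0 (s≤s (≤-reflexive (+-identityʳ l)))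

  multichoose-pascal : ∀ s m → multichoose (suc s) m + multichoose s (suc m) ≡ multichoose (suc s) (suc m)
  multichoose-pascal s m = begin
    (m + suc s ∸ 1) C m + (m + s) C suc m   ≡⟨ cong (λ x → (x ∸ 1) C m + (m + s) C suc m) (+-suc m s) ⟩
    (m + s) C m + (m + s) C suc m           ≡⟨ nCk+nC[k+1]≡[n+1]C[k+1] (m + s) m ⟩
    suc (m + s) C suc m                     ≡⟨ cong (λ x → (x ∸ 1) C suc m) (+-suc (suc m) s) ⟨
    (suc m + suc s ∸ 1) C suc m             ∎
    where open ≡-Reasoning

  multichooseProduct : ℕ → Vec ℕ m → ℕ
  multichooseProduct s []      = 1
  multichooseProduct s (x ∷ v) = multichoose s x * multichooseProduct (suc s) v

  weightedSumFrom : ℕ → Vec ℕ m → ℕ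
  weightedSumFrom s []      = 0
  weightedSumFrom s (x ∷ v) = s * x + weightedSumFrom (suc s) v

  weightedSumFrom-All≤ : ∀ {s} → 1 ≤ s → (ℓ : Vec ℕ m) → All (_≤ weightedSumFrom s ℓ) ℓ
  weightedSumFrom-All≤ 1≤s []      = []
  weightedSumFrom-All≤ {s = s} 1≤s (x ∷ ℓ) =
    ≤-trans (m≤n*m x s {{>-nonZero 1≤s}}) (m≤m+n (s * x) _) ∷
    All.map (λ {y} y≤ → ≤-trans y≤ (m≤n+m _ (s * x))) (weightedSumFrom-All≤ (s≤s z≤n) ℓ)

module Parts (n : ℕ) where

  open import Data.Nat
  open import Data.Nat.Properties
  open import Algebra.Properties.CommutativeSemigroup +-commutativeSemigroup using (xy∙z≈xz∙y)
  open import Data.Nat.Solver using (module +-*-Solver)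
  open import Data.List using (List; []; _∷_; _++_; upTo; filter; replicate; applyDownFrom; cartesianProductWith)
  open import Data.List.Properties using (filter-accept; filter-reject)
  open import Data.List.Membership.Propositional using (_∈_)
  open import Data.List.Membership.Propositional.Properties using (∈-upTo⁺; ∈-upTo⁻)
  open import Data.List.Relation.Unary.Unique.Propositional.Properties using (upTo⁺)
  open import Data.List.Relation.Binary.Permutation.Propositional using (_↭_; refl; prep; swap; trans)
  open import Relation.Nullary using (Dec; yes; no; contradiction)
  open import Relation.Binary.Definitions using (Tri; tri<; tri≈; tri>)
  open import Relation.Binary.PropositionalEquality using (_≡_; _≢_; refl; sym; cong; cong₂; subst; module ≡-Reasoning)
  import Relation.Binary.PropositionalEquality as ≡
  open import Data.Product using (_×_; _,_)
  open import Data.Vec using (Vec; []; _∷_)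
  open import Function using (_∘_)
  open +-*-Solver using (solve; _:+_; _:*_; _:=_)

  open Sums
  open Binomials
  open BoundedVectors using (vecsUpTo)

  private variable
    A : Set

  multiplicities : List ℕ
  multiplicities = upTo (suc n)

  -- withParts hs F 0 adds up F (k₁ h₁ + ⋯ + kᵣ hᵣ) over all multiplicities kᵢ ≤ n; for the
  -- indicator F of n it is the coefficient of qⁿ in ∏ 1 / (1 - q^hᵢ).
  withParts : List ℕ → (ℕ → ℕ) → ℕ → ℕ
  withParts []       F acc = F acc
  withParts (h ∷ hs) F acc = ∑[ k ← multiplicities ] withParts hs F (acc + k * h)

  Vanishing : (ℕ → ℕ) → Set
  Vanishing F = ∀ {x} → n < x → F x ≡ 0

  withParts-cong : ∀ hs {F G : ℕ → ℕ} acc → (∀ {x} → acc ≤ x → F x ≡ G x) →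
                   withParts hs F acc ≡ withParts hs G acc
  withParts-cong []       acc F≡G = F≡G ≤-refl
  withParts-cong (h ∷ hs) acc F≡G =
    ∑-cong multiplicities (λ k → withParts-cong hs _ (λ le → F≡G (≤-trans (m≤m+n acc (k * h)) le)))

  withParts-++ : ∀ hs₁ hs₂ F acc → withParts hs₁ (withParts hs₂ F) acc ≡ withParts (hs₁ ++ hs₂) F acc
  withParts-++ []        hs₂ F acc = refl
  withParts-++ (h ∷ hs₁) hs₂ F acc = ∑-cong multiplicities (λ k → withParts-++ hs₁ hs₂ F _)

  withParts-shift : ∀ hs F acc g → withParts hs F (acc + g) ≡ withParts hs (λ x → F (x + g)) acc
  withParts-shift []       F acc g = refl
  withParts-shift (h ∷ hs) F acc g = ∑-cong multiplicities (λ k →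
    ≡.trans (cong (withParts hs F) (xy∙z≈xz∙y acc g (k * h))) (withParts-shift hs F (acc + k * h) g))

  withParts-∑ : ∀ hs (xs : List A) (F : A → ℕ → ℕ) acc →
                ∑[ x ← xs ] withParts hs (F x) acc ≡ withParts hs (λ y → ∑[ x ← xs ] F x y) acc
  withParts-∑ []       xs F acc = refl
  withParts-∑ (h ∷ hs) xs F acc = ≡.trans (∑-comm xs multiplicities _)
    (∑-cong multiplicities (λ k → withParts-∑ hs xs F (acc + k * h)))

  withParts-↭ : ∀ {hs hs′} F → hs ↭ hs′ → ∀ acc → withParts hs F acc ≡ withParts hs′ F acc
  withParts-↭ F refl           acc = refl
  withParts-↭ F (prep h p)     acc = ∑-cong multiplicities (λ k → withParts-↭ F p _)
  withParts-↭ {h ∷ h′ ∷ hs} F (swap h h′ p) acc = ≡.trans (∑-comm multiplicities multiplicities _)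
    (∑-cong multiplicities λ k′ → ∑-cong multiplicities λ k →
      ≡.trans (cong (withParts hs F) (xy∙z≈xz∙y acc (k * h) (k′ * h′))) (withParts-↭ F p _))
  withParts-↭ F (trans p q)    acc = ≡.trans (withParts-↭ F p acc) (withParts-↭ F q acc)

  withParts-vanishing : ∀ hs {F} {acc} → Vanishing F → n < acc → withParts hs F acc ≡ 0
  withParts-vanishing []       F↓ n<acc = F↓ n<acc
  withParts-vanishing (h ∷ hs) {acc = acc} F↓ n<acc =
    ∑-zero multiplicities (λ {k} _ → withParts-vanishing hs F↓ (<-≤-trans n<acc (m≤m+n acc (k * h))))

  0∈multiplicities : 0 ∈ multiplicities
  0∈multiplicities = ∈-upTo⁺ (s≤s z≤n)

  withParts-drop : ∀ {h} hs {F} acc → Vanishing F → n < h → withParts (h ∷ hs) F acc ≡ withParts hs F acc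
  withParts-drop {h} hs {F} acc F↓ n<h =
    ≡.trans (∑-single multiplicities _ (upTo⁺ (suc n)) 0∈multiplicities
              (λ {k} _ k≢0 → withParts-vanishing hs F↓ (n<acc+k*h k k≢0)))
            (cong (withParts hs F) (+-identityʳ acc))
    where
    n<acc+k*h : ∀ k → k ≢ 0 → n < acc + k * h
    n<acc+k*h zero    k≢0 = contradiction refl k≢0
    n<acc+k*h (suc k) _   = <-≤-trans n<h (≤-trans (m≤m+n h (k * h)) (m≤n+m _ acc))

  withParts-filter : ∀ hs {F} acc → Vanishing F → withParts hs F acc ≡ withParts (filter (_≤? n) hs) F acc
  withParts-filter []       acc F↓ = refl
  withParts-filter (h ∷ hs) acc F↓ with h ≤? n
  ... | yes h≤n rewrite filter-accept (_≤? n) {xs = hs} h≤n =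
    ∑-cong multiplicities (λ k → withParts-filter hs _ F↓)
  ... | no h≰n rewrite filter-reject (_≤? n) {xs = hs} h≰n =
    ≡.trans (withParts-drop hs acc F↓ (≰⇒> h≰n)) (withParts-filter hs acc F↓)

  withParts-[]· : ∀ hs {P : Set} (d : Dec P) F acc → [ d ]· withParts hs F acc ≡ withParts hs (λ x → [ d ]· F x) acc
  withParts-[]· []       d F acc = refl
  withParts-[]· (h ∷ hs) d F acc = ≡.trans ([]·-∑ d multiplicities _)
    (∑-cong multiplicities (λ k → withParts-[]· hs d F (acc + k * h)))

  vanishing⇒[≤?]· : ∀ {G} → Vanishing G → ∀ x → G x ≡ [ x ≤? n ]· G x
  vanishing⇒[≤?]· G↓ x with x ≤? n
  ... | yes _  = refl
  ... | no x≰n = G↓ (≰⇒> x≰n)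

  ∑-shift : ∀ {l} G → l ≤ n → Vanishing G →
            ∑[ k ← multiplicities ] G (k + l) ≡ ∑[ m ← multiplicities ] [ l ≤? m ]· G m
  ∑-shift {l} G l≤n G↓ = ≡.trans (∑-cong multiplicities (λ k → vanishing⇒[≤?]· G↓ (k + l)))
    (∑-reindex (λ k → k + l ≤? n) (λ m → l ≤? m) (upTo⁺ (suc n)) (upTo⁺ (suc n)) (_+ l) (_∸ l) to from G)
    where
    to : ∀ {k} → k ∈ multiplicities → k + l ≤ n → (k + l ∈ multiplicities × l ≤ k + l) × k + l ∸ l ≡ k
    to {k} _ k+l≤n = (∈-upTo⁺ (s≤s k+l≤n) , m≤n+m l k) , m+n∸n≡m k l
    from : ∀ {m} → m ∈ multiplicities → l ≤ m → (m ∸ l ∈ multiplicities × m ∸ l + l ≤ n) × m ∸ l + l ≡ m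
    from {m} m∈ l≤m = (∈-upTo⁺ (s≤s (≤-trans (m∸n≤m m l) m≤n)) , ≤-trans (≤-reflexive m∸l+l≡m) m≤n) , m∸l+l≡m
      where
      m≤n = ≤-pred (∈-upTo⁻ m∈)
      m∸l+l≡m = m∸n+n≡m l≤m

  [≤?1+m]·-split : ∀ l m x → [ l ≤? suc m ]· x ≡ ([ l ≤? m ]· x) + ([ l ≟ suc m ]· x)
  [≤?1+m]·-split l m x with l ≤? m
  ... | yes l≤m = ≡.trans ([]·-yes (l ≤? suc m) (m≤n⇒m≤1+n l≤m) x)
                    (sym (≡.trans (cong (x +_) ([]·-no (l ≟ suc m) (λ { refl → 1+n≰n l≤m }) x)) (+-identityʳ x)))
  ... | no l≰m with l ≟ suc m
  ...   | yes refl  = []·-yes (suc m ≤? suc m) ≤-refl x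
  ...   | no l≢1+m  = []·-no (l ≤? suc m) (λ l≤1+m → l≢1+m (≤-antisym l≤1+m (≰⇒> l≰m))) x

  ∑-multichoose : ∀ s m → m ≤ n → ∑[ l ← multiplicities ] [ l ≤? m ]· multichoose s l ≡ multichoose (suc s) m
  ∑-multichoose s zero _ = ∑-single multiplicities _ (upTo⁺ (suc n)) 0∈multiplicities
    (λ {l} _ l≢0 → []·-no (l ≤? 0) (l≢0 ∘ n≤0⇒n≡0) (multichoose s l))
  ∑-multichoose s (suc m) 1+m≤n = begin
    ∑[ l ← multiplicities ] [ l ≤? suc m ]· multichoose s l
      ≡⟨ ∑-cong multiplicities (λ l → [≤?1+m]·-split l m (multichoose s l)) ⟩
    ∑[ l ← multiplicities ] (([ l ≤? m ]· multichoose s l) + ([ l ≟ suc m ]· multichoose s l))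
      ≡⟨ ∑-+ multiplicities (λ l → [ l ≤? m ]· multichoose s l) (λ l → [ l ≟ suc m ]· multichoose s l) ⟩
    (∑[ l ← multiplicities ] [ l ≤? m ]· multichoose s l) + (∑[ l ← multiplicities ] [ l ≟ suc m ]· multichoose s l)
      ≡⟨ cong₂ _+_ (∑-multichoose s m (≤-trans (n≤1+n m) 1+m≤n))
                   (≡.trans (∑-single multiplicities _ (upTo⁺ (suc n)) (∈-upTo⁺ (s≤s 1+m≤n)) (λ {l} _ l≢ → []·-no (l ≟ suc m) l≢ _))
                            ([]·-yes (suc m ≟ suc m) refl _)) ⟩
    multichoose (suc s) m + multichoose s (suc m)
      ≡⟨ multichoose-pascal s m ⟩
    multichoose (suc s) (suc m) ∎
    where open ≡-Reasoning

  withParts-replicate : ∀ s {h} F acc → 1 ≤ h → Vanishing F →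
                        withParts (replicate s h) F acc ≡ ∑[ l ← multiplicities ] multichoose s l * F (acc + l * h)
  withParts-replicate zero {h} F acc 1≤h F↓ = sym (≡.trans
    (∑-single multiplicities _ (upTo⁺ (suc n)) 0∈multiplicities (λ {l} _ l≢0 → cong (_* F (acc + l * h)) (multichoose-0 l≢0)))
    (≡.trans (+-identityʳ _) (cong F (+-identityʳ acc))))
  withParts-replicate (suc s) {h} F acc 1≤h F↓ = begin
    ∑[ k ← multiplicities ] withParts (replicate s h) F (acc + k * h)
      ≡⟨ ∑-cong multiplicities (λ k → withParts-replicate s F _ 1≤h F↓) ⟩
    ∑[ k ← multiplicities ] ∑[ l ← multiplicities ] multichoose s l * F (acc + k * h + l * h)
      ≡⟨ ∑-comm multiplicities multiplicities _ ⟩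
    ∑[ l ← multiplicities ] ∑[ k ← multiplicities ] multichoose s l * F (acc + k * h + l * h)
      ≡⟨ ∑-cong multiplicities (λ l → ∑-cong multiplicities (λ k → cong (λ x → multichoose s l * F x)
           (≡.trans (+-assoc acc (k * h) (l * h)) (cong (acc +_) (sym (*-distribʳ-+ h k l)))))) ⟩
    ∑[ l ← multiplicities ] ∑[ k ← multiplicities ] multichoose s l * G (k + l)
      ≡⟨ ∑-cong-local multiplicities (λ {l} l∈ → ≡.trans (sym (∑-*ˡ (multichoose s l) multiplicities (λ k → G (k + l))))
           (cong (multichoose s l *_) (∑-shift G (≤-pred (∈-upTo⁻ l∈)) G↓))) ⟩
    ∑[ l ← multiplicities ] multichoose s l * (∑[ m ← multiplicities ] [ l ≤? m ]· G m)
      ≡⟨ ∑-cong multiplicities (λ l → ≡.trans (∑-*ˡ (multichoose s l) multiplicities _)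
           (∑-cong multiplicities (λ m → *-[]· (l ≤? m) (multichoose s l) (G m)))) ⟩
    ∑[ l ← multiplicities ] ∑[ m ← multiplicities ] [ l ≤? m ]· multichoose s l * G m
      ≡⟨ ∑-comm multiplicities multiplicities _ ⟩
    ∑[ m ← multiplicities ] ∑[ l ← multiplicities ] [ l ≤? m ]· multichoose s l * G m
      ≡⟨ ∑-cong-local multiplicities (λ {m} m∈ → ≡.trans (∑-cong multiplicities (λ l → []·-*ʳ (l ≤? m) _ (G m)))
           (≡.trans (sym (∑-*ʳ (G m) multiplicities (λ l → [ l ≤? m ]· multichoose s l)))
                    (cong (_* G m) (∑-multichoose s m (≤-pred (∈-upTo⁻ m∈)))))) ⟩
    ∑[ m ← multiplicities ] multichoose (suc s) m * G m ∎
    where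
    open ≡-Reasoning
    G : ℕ → ℕ
    G m = F (acc + m * h)
    G↓ : Vanishing G
    G↓ {m} n<m = F↓ (<-≤-trans n<m (≤-trans (m≤m*n m h {{>-nonZero 1≤h}}) (m≤n+m (m * h) acc)))

  blocks : ℕ → ℕ → List ℕ
  blocks s zero    = []
  blocks s (suc m) = replicate s s ++ blocks (suc s) m

  withParts-blocks : ∀ m s F acc → 1 ≤ s → Vanishing F →
                     withParts (blocks s m) F acc
                       ≡ ∑[ v ← vecsUpTo n m ] multichooseProduct s v * F (acc + weightedSumFrom s v)
  withParts-blocks zero    s F acc 1≤s F↓ = sym (≡.trans (+-identityʳ _) (≡.trans (+-identityʳ _) (cong F (+-identityʳ acc))))
  withParts-blocks (suc m) s F acc 1≤s F↓ = begin
    withParts (replicate s s ++ blocks (suc s) m) F acc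
      ≡⟨ withParts-++ (replicate s s) (blocks (suc s) m) F acc ⟨
    withParts (replicate s s) (withParts (blocks (suc s) m) F) acc
      ≡⟨ withParts-replicate s _ acc 1≤s (withParts-vanishing (blocks (suc s) m) F↓) ⟩
    ∑[ x ← multiplicities ] multichoose s x * withParts (blocks (suc s) m) F (acc + x * s)
      ≡⟨ ∑-cong multiplicities (λ x → cong (multichoose s x *_) (withParts-blocks m (suc s) F _ (s≤s z≤n) F↓)) ⟩
    ∑[ x ← multiplicities ] multichoose s x *
      (∑[ v ← vecsUpTo n m ] multichooseProduct (suc s) v * F (acc + x * s + weightedSumFrom (suc s) v))
      ≡⟨ ∑-cong multiplicities (λ x → ≡.trans (∑-*ˡ (multichoose s x) (vecsUpTo n m) _)
           (∑-cong (vecsUpTo n m) λ v → ≡.trans (sym (*-assoc (multichoose s x) _ _))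
             (cong (λ y → multichooseProduct s (x ∷ v) * F y) (regroup x v)))) ⟩
    ∑[ x ← multiplicities ] ∑[ v ← vecsUpTo n m ] multichooseProduct s (x ∷ v) * F (acc + weightedSumFrom s (x ∷ v))
      ≡⟨ ∑-cartesianProductWith _∷_ multiplicities (vecsUpTo n m) _ ⟨
    ∑[ v ← vecsUpTo n (suc m) ] multichooseProduct s v * F (acc + weightedSumFrom s v) ∎
    where
    open ≡-Reasoning
    regroup : ∀ x v → acc + x * s + weightedSumFrom (suc s) v ≡ acc + weightedSumFrom s (x ∷ v)
    regroup x v = solve 4 (λ acc x s w → acc :+ x :* s :+ w := acc :+ (s :* x :+ w)) refl
                    acc x s (weightedSumFrom (suc s) v)

  occurrences-replicate : ∀ k y x → occurrences x (replicate k y) ≡ k * ([ y ≟ x ]· 1)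
  occurrences-replicate zero    y x = refl
  occurrences-replicate (suc k) y x = cong (([ y ≟ x ]· 1) +_) (occurrences-replicate k y x)

  occurrences-blocks : ∀ m s x → occurrences x (blocks s m) ≡ [ s ≤? x ]· [ x <? s + m ]· x
  occurrences-blocks zero    s x with s ≤? x
  ... | yes s≤x = sym ([]·-no (x <? s + 0) (λ x<s+0 → <⇒≱ (subst (x <_) (+-identityʳ s) x<s+0) s≤x) x)
  ... | no _    = refl
  occurrences-blocks (suc m) s x = begin
    occurrences x (replicate s s ++ blocks (suc s) m)
      ≡⟨ ∑-++ (replicate s s) (blocks (suc s) m) _ ⟩
    occurrences x (replicate s s) + occurrences x (blocks (suc s) m)
      ≡⟨ cong₂ _+_ (occurrences-replicate s s x) (occurrences-blocks m (suc s) x) ⟩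
    s * ([ s ≟ x ]· 1) + ([ suc s ≤? x ]· [ x <? suc s + m ]· x)
      ≡⟨ split (<-cmp s x) ⟩
    [ s ≤? x ]· [ x <? s + suc m ]· x ∎
    where
    open ≡-Reasoning
    split : Tri (s < x) (s ≡ x) (x < s) →
            s * ([ s ≟ x ]· 1) + ([ suc s ≤? x ]· [ x <? suc s + m ]· x) ≡ [ s ≤? x ]· [ x <? s + suc m ]· x
    split (tri< s<x s≢x _) rewrite []·-no (s ≟ x) s≢x 1 | *-zeroʳ s | +-suc s m
                                 | []·-yes (suc s ≤? x) s<x ([ x <? suc (s + m) ]· x)
                                 | []·-yes (s ≤? x) (<⇒≤ s<x) ([ x <? suc (s + m) ]· x) = refl
    split (tri≈ _ refl _) rewrite []·-yes (s ≟ s) refl 1 | *-identityʳ s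
                                | []·-no (suc s ≤? s) (n≮n s) ([ s <? suc s + m ]· s)
                                | []·-yes (s ≤? s) ≤-refl ([ s <? s + suc m ]· s)
                                | []·-yes (s <? s + suc m) (m<m+n s (s≤s z≤n)) s = +-identityʳ s
    split (tri> _ s≢x x<s) rewrite []·-no (s ≟ x) s≢x 1 | *-zeroʳ s
                                 | []·-no (suc s ≤? x) (<⇒≱ (<-trans x<s (n<1+n s))) ([ x <? suc s + m ]· x)
                                 | []·-no (s ≤? x) (<⇒≱ x<s) ([ x <? s + suc m ]· x) = refl

  occurrences-filter : ∀ x ys → occurrences x (filter (_≤? n) ys) ≡ [ x ≤? n ]· occurrences x ys
  occurrences-filter x ys =
    ≡.trans (∑-filter (_≤? n) ys _) (≡.trans (∑-cong ys ≤n-swap) (sym ([]·-∑ (x ≤? n) ys _)))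
    where
    ≤n-swap : ∀ y → [ y ≤? n ]· [ y ≟ x ]· 1 ≡ [ x ≤? n ]· [ y ≟ x ]· 1
    ≤n-swap y with y ≟ x
    ... | yes refl = refl
    ... | no _     = ≡.trans ([]·-zero (y ≤? n)) (sym ([]·-zero (x ≤? n)))

  hooks : List ℕ
  hooks = cartesianProductWith _+_ (applyDownFrom suc n) (upTo n)

  ∑-[a+b≟x] : ∀ {a x} → 1 ≤ a → x ≤ n → ∑[ b ← upTo n ] [ a + b ≟ x ]· 1 ≡ [ a ≤? x ]· 1
  ∑-[a+b≟x] {a} {x} 1≤a x≤n with a ≤? x
  ... | yes a≤x = ≡.trans
    (∑-single (upTo n) _ (upTo⁺ n) (∈-upTo⁺ (<-≤-trans (∸-monoʳ-< 1≤a a≤x) x≤n))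
      (λ {b} _ b≢x∸a → []·-no (a + b ≟ x) (λ a+b≡x → b≢x∸a (≡.trans (sym (m+n∸m≡n a b)) (cong (_∸ a) a+b≡x))) 1))
    ([]·-yes (a + (x ∸ a) ≟ x) (m+[n∸m]≡n a≤x) 1)
  ... | no a≰x = ∑-zero (upTo n) (λ {b} _ → []·-no (a + b ≟ x) (λ { refl → a≰x (m≤m+n a b) }) 1)

  occurrences-hooks : ∀ x → x ≤ n → occurrences x hooks ≡ x
  occurrences-hooks x x≤n = ≡.trans (∑-cartesianProductWith _+_ (applyDownFrom suc n) (upTo n) _)
    (≡.trans (count n) (m≥n⇒m⊓n≡n x≤n))
    where
    count : ∀ m → ∑[ a ← applyDownFrom suc m ] ∑[ b ← upTo n ] [ a + b ≟ x ]· 1 ≡ m ⊓ x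
    count zero    = refl
    count (suc m) = ≡.trans (cong₂ _+_ (∑-[a+b≟x] (s≤s z≤n) x≤n) (count m)) (add-1+m (suc m ≤? x))
      where
      add-1+m : (d : Dec (suc m ≤ x)) → ([ d ]· 1) + m ⊓ x ≡ suc m ⊓ x
      add-1+m (yes 1+m≤x) = ≡.trans (cong suc (m≤n⇒m⊓n≡m (≤-trans (n≤1+n m) 1+m≤x))) (sym (m≤n⇒m⊓n≡m 1+m≤x))
      add-1+m (no 1+m≰x)  = ≡.trans (m≥n⇒m⊓n≡n (≤-pred (≰⇒> 1+m≰x))) (sym (m≥n⇒m⊓n≡n (≤-trans (≤-pred (≰⇒> 1+m≰x)) (n≤1+n m))))

  withParts-hooks : ∀ {F} → Vanishing F → withParts hooks F 0 ≡ withParts (blocks 1 n) F 0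
  withParts-hooks {F} F↓ = ≡.trans (withParts-filter hooks 0 F↓)
    (withParts-↭ F (↭-occurrences (filter (_≤? n) hooks) (blocks 1 n) same-occurrences) 0)
    where
    same-occurrences : ∀ x → occurrences x (filter (_≤? n) hooks) ≡ occurrences x (blocks 1 n)
    same-occurrences x rewrite occurrences-filter x hooks | occurrences-blocks n 1 x with x ≤? n
    ... | yes x≤n rewrite occurrences-hooks x x≤n = in-range x x≤n
      where
      in-range : ∀ x → x ≤ n → x ≡ [ 1 ≤? x ]· [ x <? 1 + n ]· x
      in-range zero    _   = refl
      in-range (suc x) x≤n = sym (≡.trans ([]·-yes (1 ≤? suc x) (s≤s z≤n) _) ([]·-yes (suc x <? 1 + n) (s≤s x≤n) _))
    ... | no x≰n  = sym (≡.trans (cong ([ 1 ≤? x ]·_) ([]·-no (x <? 1 + n) (x≰n ∘ ≤-pred) x)) ([]·-zero (1 ≤? x)))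

module Transfer (n : ℕ) where

  open import Data.Nat
  open import Data.Nat.Properties
  open import Data.Nat.Solver using (module +-*-Solver)
  open import Data.List using (List; []; _∷_; [_]; _++_; map; cartesianProduct; cartesianProductWith)
  open import Data.List.Properties using (++-identityʳ)
  open import Data.List.Membership.Propositional using (_∈_)
  open import Data.List.Membership.Propositional.Properties using (∈-upTo⁺; ∈-cartesianProduct⁺)
  open import Data.List.Relation.Unary.All as List using ([]; _∷_)
  open import Data.List.Relation.Unary.Unique.Propositional.Properties using (upTo⁺; cartesianProduct⁺)
  import Data.List.Relation.Binary.Permutation.Propositional.Properties as ↭
  open import Data.Vec using (Vec; []; _∷_; sum; replicate; last)
  open import Data.Vec.Properties using (≡-dec)
  open import Data.Vec.Relation.Unary.All using (All; _∷_)
  open import Data.Product using (_×_; _,_; proj₁; proj₂)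
  open import Data.Unit using (⊤; tt)
  open import Relation.Nullary using (Dec; yes; no; contradiction)
  open import Relation.Nullary.Decidable using (_×-dec_)
  open import Relation.Binary.PropositionalEquality hiding ([_])
  open import Function using (_∘_)
  open +-*-Solver using (solve; _:+_; _:*_; _:=_)

  open Sums
  open BoundedVectors
  open Interlacing
  open Parts n

  -- A slice has n + 1 parts: a slice of size at most n then has last part 0, so that the local
  -- rule below never overflows (overflow≡0).
  Slice : Set
  Slice = Vec ℕ (suc n)

  slices : List Slice
  slices = vecsUpTo n (suc n)

  empty : Slice
  empty = replicate (suc n) 0

  _≟ₛ_ : (α β : Slice) → Dec (α ≡ β)
  _≟ₛ_ = ≡-dec _≟_

  data Step : Set where
    up down : ℕ → Step

  Adjacent : Step → Slice → Slice → Set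
  Adjacent (up _)   α κ = α ≺ κ
  Adjacent (down _) α μ = μ ≺ α

  adjacent? : (s : Step) (α β : Slice) → Dec (Adjacent s α β)
  adjacent? (up _)   α κ = α ≺? κ
  adjacent? (down _) α μ = μ ≺? α

  gain : Step → Slice → Slice → ℕ
  gain (up a)   α κ = a * (sum κ ∸ sum α)
  gain (down b) α μ = b * (sum α ∸ sum μ)

  #walks : Slice → List Step → ℕ → ℕ
  #walks α []      acc = [ α ≟ₛ empty ]· [ acc ≟ n ]· 1
  #walks α (s ∷ w) acc = ∑[ β ← slices ] [ adjacent? s α β ]· #walks β w (acc + gain s α β)

  #walks-vanishing : ∀ α w {acc} → n < acc → #walks α w acc ≡ 0
  #walks-vanishing α []      {acc} n<acc with α ≟ₛ empty | acc ≟ n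
  ... | yes _ | yes refl = contradiction n<acc (n≮n n)
  ... | yes _ | no _     = refl
  ... | no _  | _        = refl
  #walks-vanishing α (s ∷ w) {acc} n<acc = ∑-zero slices λ {β} _ →
    trans (cong [ adjacent? s α β ]·_ (#walks-vanishing β w (<-≤-trans n<acc (m≤m+n acc _))))
          ([]·-zero (adjacent? s α β))

  module LocalRule (a b : ℕ) (α ν : Slice) where

    upGain : Slice → ℕ
    upGain κ = a * (sum κ ∸ sum α) + b * (sum κ ∸ sum ν)

    downGain : ℕ × Slice → ℕ
    downGain (k , μ) = k * (a + b) + b * (sum α ∸ sum μ) + a * (sum ν ∸ sum μ)

    upGain-grow : ∀ k {μ} → μ ≺ α → μ ≺ ν → last α ≡ 0 → upGain (grow k α ν μ) ≡ downGain (k , μ)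
    upGain-grow k {μ} μ≺α μ≺ν α₋₁≡0 = begin
      a * (sum (grow k α ν μ) ∸ sum α) + b * (sum (grow k α ν μ) ∸ sum ν)
        ≡⟨ cong₂ (λ x y → a * x + b * y) (sum-grow∸ˡ k μ≺α μ≺ν o≡0) (sum-grow∸ʳ k μ≺α μ≺ν o≡0) ⟩
      a * (sum ν ∸ sum μ + k) + b * (sum α ∸ sum μ + k)
        ≡⟨ solve 5 (λ a b x y k → a :* (x :+ k) :+ b :* (y :+ k) := k :* (a :+ b) :+ b :* y :+ a :* x) refl
                 a b (sum ν ∸ sum μ) (sum α ∸ sum μ) k ⟩
      downGain (k , μ) ∎
      where
      open ≡-Reasoning
      o≡0 : overflow k α ν μ ≡ 0
      o≡0 = overflow≡0 k α ν μ α₋₁≡0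

    k+Δν≤downGain : ∀ k μ → 1 ≤ a → k + (sum ν ∸ sum μ) ≤ downGain (k , μ)
    k+Δν≤downGain k μ 1≤a = +-mono-≤
      (≤-trans (m≤m*n k (a + b) {{>-nonZero (≤-trans 1≤a (m≤m+n a b))}}) (m≤m+n _ _))
      (m≤n*m (sum ν ∸ sum μ) a {{>-nonZero 1≤a}})

    sum-grow≤n : ∀ k {acc μ} → sum α ≤ acc → acc ≤ n → 1 ≤ a → μ ≺ α → μ ≺ ν → last α ≡ 0 →
                 downGain (k , μ) ≤ n ∸ acc → sum (grow k α ν μ) ≤ n
    sum-grow≤n k {acc} {μ} Σα≤acc acc≤n 1≤a μ≺α μ≺ν α₋₁≡0 g≤n∸acc = begin
      sum (grow k α ν μ)                   ≡⟨ m+[n∸m]≡n (≺-sum (proj₁ (≺-grow k μ≺α μ≺ν))) ⟨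
      sum α + (sum (grow k α ν μ) ∸ sum α) ≡⟨ cong (sum α +_) (sum-grow∸ˡ k μ≺α μ≺ν (overflow≡0 k α ν μ α₋₁≡0)) ⟩
      sum α + (sum ν ∸ sum μ + k)          ≡⟨ cong (sum α +_) (+-comm _ k) ⟩
      sum α + (k + (sum ν ∸ sum μ))        ≤⟨ +-mono-≤ Σα≤acc (≤-trans (k+Δν≤downGain k μ 1≤a) g≤n∸acc) ⟩
      acc + (n ∸ acc)                      ≡⟨ m+[n∸m]≡n acc≤n ⟩
      n                                    ∎
      where open ≤-Reasoning

    ∑-localRule : ∀ {acc} → 1 ≤ a → sum α ≤ acc → acc ≤ n → (G : ℕ → ℕ) → (∀ {x} → n ∸ acc < x → G x ≡ 0) →
                  ∑[ κ ← slices ] [ α ≺? κ ×-dec ν ≺? κ ]· G (upGain κ)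
                    ≡ ∑[ p ← cartesianProduct multiplicities slices ] [ proj₂ p ≺? α ×-dec proj₂ p ≺? ν ]· G (downGain p)
    ∑-localRule {acc} 1≤a Σα≤acc acc≤n G G↓ = begin
      ∑[ κ ← slices ] [ α ≺? κ ×-dec ν ≺? κ ]· G (upGain κ)
        ≡⟨ ∑-cong slices (λ κ → []·-restrict (α ≺? κ ×-dec ν ≺? κ) (upGain κ ≤? W) _ (λ _ → G↓ ∘ ≰⇒>)) ⟩
      ∑[ κ ← slices ] [ Q? κ ]· G (upGain κ)
        ≡⟨ ∑-reindex P? Q? (cartesianProduct⁺ (upTo⁺ (suc n)) (vecsUpTo-unique n (suc n))) (vecsUpTo-unique n (suc n))
             grow′ shrink′ grow∈ shrink∈ (G ∘ upGain) ⟨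
      ∑[ p ← pairs ] [ P? p ]· G (upGain (grow′ p))
        ≡⟨ ∑-cong pairs (λ p → []·-cong (P? p) (λ ((μ≺α , μ≺ν) , _) → cong G (upGain-grow (proj₁ p) μ≺α μ≺ν (α₋₁≡0 μ≺α)))) ⟩
      ∑[ p ← pairs ] [ P? p ]· G (downGain p)
        ≡⟨ ∑-cong pairs (λ p → []·-restrict (proj₂ p ≺? α ×-dec proj₂ p ≺? ν) (downGain p ≤? W) _ (λ _ → G↓ ∘ ≰⇒>)) ⟨
      ∑[ p ← pairs ] [ proj₂ p ≺? α ×-dec proj₂ p ≺? ν ]· G (downGain p) ∎
      where
      open ≡-Reasoning
      W = n ∸ acc
      pairs = cartesianProduct multiplicities slices
      P? = λ (p : ℕ × Slice) → (proj₂ p ≺? α ×-dec proj₂ p ≺? ν) ×-dec downGain p ≤? W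
      Q? = λ (κ : Slice) → (α ≺? κ ×-dec ν ≺? κ) ×-dec upGain κ ≤? W
      grow′ : ℕ × Slice → Slice
      grow′ (k , μ) = grow k α ν μ
      shrink′ : Slice → ℕ × Slice
      shrink′ κ = shrink κ α ν
      Σα≤n : sum α ≤ n
      Σα≤n = ≤-trans Σα≤acc acc≤n
      α₋₁≡0 : ∀ {μ} → μ ≺ α → last α ≡ 0
      α₋₁≡0 μ≺α = ≺-last≡0 μ≺α Σα≤n
      grow∈ : ∀ {p} → p ∈ pairs → (proj₂ p ≺ α × proj₂ p ≺ ν) × downGain p ≤ W →
              (grow′ p ∈ slices × (α ≺ grow′ p × ν ≺ grow′ p) × upGain (grow′ p) ≤ W) × shrink′ (grow′ p) ≡ p
      grow∈ {k , μ} _ ((μ≺α , μ≺ν) , g≤W) =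
        (∈-vecsUpTo⁺ (sum≤⇒All≤ _ (sum-grow≤n k Σα≤acc acc≤n 1≤a μ≺α μ≺ν (α₋₁≡0 μ≺α) g≤W)) ,
         ≺-grow k μ≺α μ≺ν , subst (_≤ W) (sym (upGain-grow k μ≺α μ≺ν (α₋₁≡0 μ≺α))) g≤W) ,
        shrink-grow k μ≺α μ≺ν (overflow≡0 k α ν μ (α₋₁≡0 μ≺α))
      shrink∈ : ∀ {κ} → κ ∈ slices → (α ≺ κ × ν ≺ κ) × upGain κ ≤ W →
                (shrink′ κ ∈ pairs × (proj₂ (shrink′ κ) ≺ α × proj₂ (shrink′ κ) ≺ ν) × downGain (shrink′ κ) ≤ W) ×
                grow′ (shrink′ κ) ≡ κ
      shrink∈ {κ} κ∈ ((α≺κ , ν≺κ) , g≤W) =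
        (∈-cartesianProduct⁺ (∈-upTo⁺ (s≤s k≤n)) (∈-vecsUpTo⁺ (≺-All≤ μ≺α (sum≤⇒All≤ α Σα≤n))) ,
         (μ≺α , μ≺ν) , subst (_≤ W) (trans (cong upGain (sym grow∘shrink)) (upGain-grow _ μ≺α μ≺ν (α₋₁≡0 μ≺α))) g≤W) ,
        grow∘shrink
        where
        μ≺α : proj₂ (shrink′ κ) ≺ α
        μ≺α = proj₁ (shrink-≺ α≺κ ν≺κ)
        μ≺ν : proj₂ (shrink′ κ) ≺ ν
        μ≺ν = proj₂ (shrink-≺ α≺κ ν≺κ)
        grow∘shrink : grow′ (shrink′ κ) ≡ κ
        grow∘shrink = grow-shrink α≺κ ν≺κ
        k≤n : proj₁ (shrink κ α ν) ≤ n
        k≤n rewrite proj₁-shrink κ α ν = ≤-trans (m∸n≤m (head₀ κ) (head₀ α ⊔ head₀ ν)) (head₀-All≤ (∈-vecsUpTo⁻ κ∈))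

  #walks-commute : ∀ {a} b w → 1 ≤ a → ∀ {α acc} → sum α ≤ acc →
                   #walks α (up a ∷ down b ∷ w) acc ≡ withParts [ a + b ] (#walks α (down b ∷ up a ∷ w)) acc
  #walks-commute {a} b w 1≤a {α} {acc} Σα≤acc with n <? acc
  ... | yes n<acc = trans (#walks-vanishing α (up a ∷ down b ∷ w) n<acc)
                          (sym (withParts-vanishing [ a + b ] (#walks-vanishing α (down b ∷ up a ∷ w)) n<acc))
  ... | no n≮acc = begin
    ∑[ κ ← slices ] [ α ≺? κ ]· ∑[ ν ← slices ] [ ν ≺? κ ]· #walks ν w (acc + a * (sum κ ∸ sum α) + b * (sum κ ∸ sum ν))
      ≡⟨ ∑-cong slices (λ κ → []·-∑ (α ≺? κ) slices _) ⟩
    ∑[ κ ← slices ] ∑[ ν ← slices ] [ α ≺? κ ]· [ ν ≺? κ ]· #walks ν w (acc + a * (sum κ ∸ sum α) + b * (sum κ ∸ sum ν))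
      ≡⟨ ∑-comm slices slices _ ⟩
    ∑[ ν ← slices ] ∑[ κ ← slices ] [ α ≺? κ ]· [ ν ≺? κ ]· #walks ν w (acc + a * (sum κ ∸ sum α) + b * (sum κ ∸ sum ν))
      ≡⟨ ∑-cong slices (λ ν → ∑-cong slices (λ κ →
           trans ([]·-× (α ≺? κ) (ν ≺? κ) _) (cong (λ x → [ α ≺? κ ×-dec ν ≺? κ ]· #walks ν w x) (+-assoc acc _ _)))) ⟩
    ∑[ ν ← slices ] ∑[ κ ← slices ] [ α ≺? κ ×-dec ν ≺? κ ]· #walks ν w (acc + upGain ν κ)
      ≡⟨ ∑-cong slices (λ ν → ∑-localRule ν 1≤a Σα≤acc acc≤n (λ x → #walks ν w (acc + x)) (#walks-vanishing ν w ∘ n<acc+)) ⟩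
    ∑[ ν ← slices ] ∑[ p ← cartesianProduct multiplicities slices ] [ proj₂ p ≺? α ×-dec proj₂ p ≺? ν ]· #walks ν w (acc + downGain ν p)
      ≡⟨ ∑-cong slices (λ ν → ∑-cartesianProductWith _,_ multiplicities slices _) ⟩
    ∑[ ν ← slices ] ∑[ k ← multiplicities ] ∑[ μ ← slices ] [ μ ≺? α ×-dec μ ≺? ν ]· #walks ν w (acc + downGain ν (k , μ))
      ≡⟨ ∑-comm slices multiplicities _ ⟩
    ∑[ k ← multiplicities ] ∑[ ν ← slices ] ∑[ μ ← slices ] [ μ ≺? α ×-dec μ ≺? ν ]· #walks ν w (acc + downGain ν (k , μ))
      ≡⟨ ∑-cong multiplicities (λ k → ∑-comm slices slices _) ⟩
    ∑[ k ← multiplicities ] ∑[ μ ← slices ] ∑[ ν ← slices ] [ μ ≺? α ×-dec μ ≺? ν ]· #walks ν w (acc + downGain ν (k , μ))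
      ≡⟨ ∑-cong multiplicities (λ k → ∑-cong slices (λ μ → trans ([]·-∑ (μ ≺? α) slices _) (∑-cong slices (λ ν →
           trans ([]·-× (μ ≺? α) (μ ≺? ν) _) (cong (λ x → [ μ ≺? α ×-dec μ ≺? ν ]· #walks ν w x) (regroup k μ ν)))))) ⟨
    ∑[ k ← multiplicities ] ∑[ μ ← slices ] [ μ ≺? α ]· ∑[ ν ← slices ] [ μ ≺? ν ]·
      #walks ν w (acc + k * (a + b) + b * (sum α ∸ sum μ) + a * (sum ν ∸ sum μ)) ∎
    where
    open ≡-Reasoning
    open module Rule (ν : Slice) = LocalRule a b α ν
    acc≤n : acc ≤ n
    acc≤n = ≮⇒≥ n≮acc
    n<acc+ : ∀ {x} → n ∸ acc < x → n < acc + x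
    n<acc+ {x} n∸acc<x = subst (_< acc + x) (m+[n∸m]≡n acc≤n) (+-monoʳ-< acc n∸acc<x)
    regroup : ∀ k μ ν → acc + k * (a + b) + b * (sum α ∸ sum μ) + a * (sum ν ∸ sum μ) ≡ acc + downGain ν (k , μ)
    regroup k μ ν = solve 4 (λ c x y z → c :+ x :+ y :+ z := c :+ (x :+ y :+ z)) refl
                      acc (k * (a + b)) (b * (sum α ∸ sum μ)) (a * (sum ν ∸ sum μ))

  Positive : Step → Set
  Positive (up a)   = 1 ≤ a
  Positive (down _) = ⊤

  sum≤acc+gain : ∀ s {α β acc} → Positive s → Adjacent s α β → sum α ≤ acc → sum β ≤ acc + gain s α β
  sum≤acc+gain (up a)   {α} {κ} {acc} 1≤a α≺κ Σα≤acc = begin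
    sum κ                           ≡⟨ m+[n∸m]≡n (≺-sum α≺κ) ⟨
    sum α + (sum κ ∸ sum α)         ≤⟨ +-mono-≤ Σα≤acc (m≤n*m (sum κ ∸ sum α) a {{>-nonZero 1≤a}}) ⟩
    acc + a * (sum κ ∸ sum α)       ∎
    where open ≤-Reasoning
  sum≤acc+gain (down b) {acc = acc} _ μ≺α Σα≤acc = ≤-trans (≺-sum μ≺α) (≤-trans Σα≤acc (m≤m+n acc _))

  #walks-under : ∀ hs w₁ w₂ →
                 (∀ {α acc} → sum α ≤ acc → #walks α w₁ acc ≡ withParts hs (#walks α w₂) acc) →
                 ∀ pre → List.All Positive pre → ∀ {α acc} → sum α ≤ acc →
                 #walks α (pre ++ w₁) acc ≡ withParts hs (#walks α (pre ++ w₂)) acc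
  #walks-under hs w₁ w₂ base []        []           Σα≤acc = base Σα≤acc
  #walks-under hs w₁ w₂ base (s ∷ pre) (s⁺ ∷ pre⁺) {α} {acc} Σα≤acc = begin
    ∑[ β ← slices ] [ adjacent? s α β ]· #walks β (pre ++ w₁) (acc + gain s α β)
      ≡⟨ ∑-cong slices (λ β → []·-cong (adjacent? s α β) (λ adj →
           #walks-under hs w₁ w₂ base pre pre⁺ (sum≤acc+gain s s⁺ adj Σα≤acc))) ⟩
    ∑[ β ← slices ] [ adjacent? s α β ]· withParts hs (#walks β (pre ++ w₂)) (acc + gain s α β)
      ≡⟨ ∑-cong slices (λ β → trans (cong [ adjacent? s α β ]·_ (withParts-shift hs _ acc _))
                                     (withParts-[]· hs (adjacent? s α β) _ acc)) ⟩
    ∑[ β ← slices ] withParts hs (λ x → [ adjacent? s α β ]· #walks β (pre ++ w₂) (x + gain s α β)) acc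
      ≡⟨ withParts-∑ hs slices _ acc ⟩
    withParts hs (#walks α (s ∷ pre ++ w₂)) acc ∎
    where open ≡-Reasoning

  #walks-up-past-downs : ∀ {a} bs post → 1 ≤ a → ∀ {α acc} → sum α ≤ acc →
                         #walks α (up a ∷ map down bs ++ post) acc
                           ≡ withParts (map (a +_) bs) (#walks α (map down bs ++ up a ∷ post)) acc
  #walks-up-past-downs           []       post 1≤a Σα≤acc = refl
  #walks-up-past-downs {a} (b ∷ bs) post 1≤a {α} {acc} Σα≤acc = begin
    #walks α (up a ∷ down b ∷ map down bs ++ post) acc
      ≡⟨ #walks-commute b (map down bs ++ post) 1≤a Σα≤acc ⟩
    withParts [ a + b ] (#walks α (down b ∷ up a ∷ map down bs ++ post)) acc
      ≡⟨ withParts-cong [ a + b ] acc (λ acc≤x →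
           #walks-under (map (a +_) bs) (up a ∷ map down bs ++ post) (map down bs ++ up a ∷ post)
             (#walks-up-past-downs bs post 1≤a) [ down b ] (tt ∷ []) {α} (≤-trans Σα≤acc acc≤x)) ⟩
    withParts [ a + b ] (withParts (map (a +_) bs) (#walks α (down b ∷ map down bs ++ up a ∷ post))) acc
      ≡⟨ withParts-++ [ a + b ] (map (a +_) bs) _ acc ⟩
    withParts (map (a +_) (b ∷ bs)) (#walks α (map down (b ∷ bs) ++ up a ∷ post)) acc ∎
    where open ≡-Reasoning

  #walks-ups-past-downs : ∀ as bs post → List.All (1 ≤_) as → ∀ {α acc} → sum α ≤ acc →
                          #walks α (map up as ++ map down bs ++ post) acc
                            ≡ withParts (cartesianProductWith _+_ as bs) (#walks α (map down bs ++ map up as ++ post)) acc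
  #walks-ups-past-downs []       bs post []           Σα≤acc = refl
  #walks-ups-past-downs (a ∷ as) bs post (1≤a ∷ as⁺) {α} {acc} Σα≤acc = begin
    #walks α (up a ∷ map up as ++ map down bs ++ post) acc
      ≡⟨ #walks-under sums (map up as ++ map down bs ++ post) (map down bs ++ map up as ++ post)
           (#walks-ups-past-downs as bs post as⁺) [ up a ] (1≤a ∷ []) Σα≤acc ⟩
    withParts sums (#walks α (up a ∷ map down bs ++ map up as ++ post)) acc
      ≡⟨ withParts-cong sums acc (λ acc≤x → #walks-up-past-downs bs (map up as ++ post) 1≤a (≤-trans Σα≤acc acc≤x)) ⟩
    withParts sums (withParts (map (a +_) bs) (#walks α (map down bs ++ map up (a ∷ as) ++ post))) acc
      ≡⟨ withParts-++ sums (map (a +_) bs) _ acc ⟩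
    withParts (sums ++ map (a +_) bs) (#walks α (map down bs ++ map up (a ∷ as) ++ post)) acc
      ≡⟨ withParts-↭ _ (↭.++-comm sums (map (a +_) bs)) acc ⟩
    withParts (cartesianProductWith _+_ (a ∷ as) bs) (#walks α (map down bs ++ map up (a ∷ as) ++ post)) acc ∎
    where
    open ≡-Reasoning
    sums = cartesianProductWith _+_ as bs

  empty∈slices : empty ∈ slices
  empty∈slices = ∈-vecsUpTo⁺ (sum≤⇒All≤ empty (subst (_≤ n) (sym (sum-replicate-0 (suc n))) z≤n))

  private
    acc+c*0≡acc : ∀ acc c → acc + c * (sum empty ∸ sum empty) ≡ acc
    acc+c*0≡acc acc c = trans (cong (λ x → acc + c * x) (n∸n≡0 (sum empty)))
                              (trans (cong (acc +_) (*-zeroʳ c)) (+-identityʳ acc))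

  #walks-empty-downs : ∀ bs w acc → #walks empty (map down bs ++ w) acc ≡ #walks empty w acc
  #walks-empty-downs []       w acc = refl
  #walks-empty-downs (b ∷ bs) w acc = begin
    ∑[ μ ← slices ] [ μ ≺? empty ]· #walks μ (map down bs ++ w) (acc + b * (sum empty ∸ sum μ))
      ≡⟨ ∑-single slices _ (vecsUpTo-unique n (suc n)) empty∈slices
           (λ {μ} _ μ≢∅ → []·-no (μ ≺? empty) (μ≢∅ ∘ ≺0⇒≡0 μ) _) ⟩
    [ empty ≺? empty ]· #walks empty (map down bs ++ w) (acc + b * (sum empty ∸ sum empty))
      ≡⟨ []·-yes (empty ≺? empty) 0≺0 _ ⟩
    #walks empty (map down bs ++ w) (acc + b * (sum empty ∸ sum empty))
      ≡⟨ cong (#walks empty (map down bs ++ w)) (acc+c*0≡acc acc b) ⟩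
    #walks empty (map down bs ++ w) acc
      ≡⟨ #walks-empty-downs bs w acc ⟩
    #walks empty w acc ∎
    where open ≡-Reasoning

  #walks-ups-nonempty : ∀ as {α} acc → α ≢ empty → #walks α (map up as) acc ≡ 0
  #walks-ups-nonempty []       {α} acc α≢∅ = []·-no (α ≟ₛ empty) α≢∅ _
  #walks-ups-nonempty (a ∷ as) {α} acc α≢∅ = ∑-zero slices λ {κ} _ →
    trans ([]·-cong (α ≺? κ) (λ α≺κ → #walks-ups-nonempty as _ (λ { refl → α≢∅ (≺0⇒≡0 α α≺κ) })))
          ([]·-zero (α ≺? κ))

  #walks-empty-ups : ∀ as acc → #walks empty (map up as) acc ≡ [ acc ≟ n ]· 1
  #walks-empty-ups []       acc = []·-yes (empty ≟ₛ empty) refl _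
  #walks-empty-ups (a ∷ as) acc = begin
    ∑[ κ ← slices ] [ empty ≺? κ ]· #walks κ (map up as) (acc + a * (sum κ ∸ sum empty))
      ≡⟨ ∑-single slices _ (vecsUpTo-unique n (suc n)) empty∈slices
           (λ {κ} _ κ≢∅ → trans ([]·-cong (empty ≺? κ) (λ _ → #walks-ups-nonempty as _ κ≢∅)) ([]·-zero (empty ≺? κ))) ⟩
    [ empty ≺? empty ]· #walks empty (map up as) (acc + a * (sum empty ∸ sum empty))
      ≡⟨ []·-yes (empty ≺? empty) 0≺0 _ ⟩
    #walks empty (map up as) (acc + a * (sum empty ∸ sum empty))
      ≡⟨ cong (#walks empty (map up as)) (acc+c*0≡acc acc a) ⟩
    #walks empty (map up as) acc
      ≡⟨ #walks-empty-ups as acc ⟩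
    [ acc ≟ n ]· 1 ∎
    where open ≡-Reasoning

  #walks-up-down : ∀ as bs → List.All (1 ≤_) as →
                   #walks empty (map up as ++ map down bs) 0 ≡ withParts (cartesianProductWith _+_ as bs) (λ x → [ x ≟ n ]· 1) 0
  #walks-up-down as bs as⁺ = begin
    #walks empty (map up as ++ map down bs) 0
      ≡⟨ cong (λ w → #walks empty (map up as ++ w) 0) (++-identityʳ (map down bs)) ⟨
    #walks empty (map up as ++ map down bs ++ []) 0
      ≡⟨ #walks-ups-past-downs as bs [] as⁺ (≤-reflexive (sum-replicate-0 (suc n))) ⟩
    withParts (cartesianProductWith _+_ as bs) (#walks empty (map down bs ++ map up as ++ [])) 0
      ≡⟨ withParts-cong (cartesianProductWith _+_ as bs) 0 (λ {x} _ → begin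
           #walks empty (map down bs ++ map up as ++ []) x ≡⟨ #walks-empty-downs bs _ x ⟩
           #walks empty (map up as ++ []) x               ≡⟨ cong (λ w → #walks empty w x) (++-identityʳ (map up as)) ⟩
           #walks empty (map up as) x                     ≡⟨ #walks-empty-ups as x ⟩
           [ x ≟ n ]· 1                                   ∎) ⟩
    withParts (cartesianProductWith _+_ as bs) (λ x → [ x ≟ n ]· 1) 0 ∎
    where open ≡-Reasoning

module Slicing where

  open import Data.Nat
  open import Data.Nat.Properties
  open import Data.Vec
    using (Vec; []; _∷_; head; tail; map; zipWith; replicate; sum; init; last; _∷ʳ_; initLast; reverse; _++_)
  open import Data.Vec.Relation.Unary.All as All using (All; []; _∷_)
  open import Data.Vec.Properties using (init-∷ʳ; reverse-∷)
  open import Data.Product using (_×_; _,_; proj₁; proj₂)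
  open import Data.Unit using (⊤; tt)
  open import Relation.Binary.PropositionalEquality
  open import Data.Nat.Solver using (module +-*-Solver)
  open +-*-Solver using (solve; _:+_; _:=_)

  open import Defs using (Array)
  open Interlacing

  private variable
    A : Set
    k m : ℕ

  zeros : ∀ k → Vec ℕ k
  zeros k = replicate k 0

  -- The diagonal slices of an array: upper a lists the diagonals starting in the first row,
  -- lower a those starting in the first column below the corner (the last one is zero), all
  -- padded to m + 1 parts; glue reassembles the array.
  upper : Array m → Vec (Vec ℕ (suc m)) m
  upper {zero}  []         = []
  upper {suc m} (r ∷ rows) = zipWith _∷_ r (upper (map tail rows) ∷ʳ zeros (suc m))

  lower : Array m → Vec (Vec ℕ (suc m)) m
  lower {zero}  []         = []
  lower {suc m} (r ∷ rows) = zipWith _∷_ (map head rows ∷ʳ 0) (lower (map tail rows) ∷ʳ zeros (suc m))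

  glue : Vec (Vec ℕ (suc m)) m → Vec (Vec ℕ (suc m)) m → Array m
  glue {zero}  []  []  = []
  glue {suc m} U L = map head U ∷ zipWith _∷_ (init (map head L)) (glue (init (map tail U)) (init (map tail L)))

  map-head-zipWith : (xs : Vec A m) (ys : Vec (Vec A k) m) → map head (zipWith _∷_ xs ys) ≡ xs
  map-head-zipWith []       []       = refl
  map-head-zipWith (x ∷ xs) (y ∷ ys) = cong (x ∷_) (map-head-zipWith xs ys)

  map-tail-zipWith : (xs : Vec A m) (ys : Vec (Vec A k) m) → map tail (zipWith _∷_ xs ys) ≡ ys
  map-tail-zipWith []       []       = refl
  map-tail-zipWith (x ∷ xs) (y ∷ ys) = cong (y ∷_) (map-tail-zipWith xs ys)

  zipWith-head-tail : (rows : Vec (Vec A (suc k)) m) → zipWith _∷_ (map head rows) (map tail rows) ≡ rows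
  zipWith-head-tail []                = refl
  zipWith-head-tail ((x ∷ r) ∷ rows) = cong ((x ∷ r) ∷_) (zipWith-head-tail rows)

  glue-upper-lower : (a : Array m) → glue (upper a) (lower a) ≡ a
  glue-upper-lower {zero}  []         = refl
  glue-upper-lower {suc m} (r ∷ rows) = cong₂ _∷_ (map-head-zipWith r _) (begin
    zipWith _∷_ (init (map head (lower (r ∷ rows))))
                (glue (init (map tail (upper (r ∷ rows)))) (init (map tail (lower (r ∷ rows)))))
      ≡⟨ cong₂ (λ c a′ → zipWith _∷_ c a′)
           (trans (cong init (map-head-zipWith _ _)) (init-∷ʳ 0 (map head rows)))
           (cong₂ glue (trans (cong init (map-tail-zipWith r _)) (init-∷ʳ _ _))
                       (trans (cong init (map-tail-zipWith _ _)) (init-∷ʳ _ _))) ⟩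
    zipWith _∷_ (map head rows) (glue (upper (map tail rows)) (lower (map tail rows)))
      ≡⟨ cong (zipWith _∷_ (map head rows)) (glue-upper-lower (map tail rows)) ⟩
    zipWith _∷_ (map head rows) (map tail rows)
      ≡⟨ zipWith-head-tail rows ⟩
    rows ∎)
    where open ≡-Reasoning

  firstOr0 : Vec (Vec ℕ k) m → Vec ℕ k
  firstOr0 {k} []      = zeros k
  firstOr0     (u ∷ _) = u

  lastOr : A → Vec A m → A
  lastOr x []       = x
  lastOr _ (v ∷ vs) = lastOr v vs

  DescendingTo0 : Vec (Vec ℕ k) m → Set
  DescendingTo0 []      = ⊤
  DescendingTo0 (u ∷ U) = firstOr0 U ≺ u × DescendingTo0 U

  DescendingFrom : Vec ℕ k → Vec (Vec ℕ k) m → Set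
  DescendingFrom x []       = ⊤
  DescendingFrom x (v ∷ vs) = v ≺ x × DescendingFrom v vs

  Sliced : Vec (Vec ℕ k) m → Vec (Vec ℕ k) m → Set
  Sliced {k} U L = DescendingTo0 U × DescendingFrom (firstOr0 U) L × lastOr (firstOr0 U) L ≡ zeros k

  Decreasing : Vec ℕ m → Set
  Decreasing []       = ⊤
  Decreasing (x ∷ xs) = head₀ xs ≤ x × Decreasing xs

  infix 4 _≤*_
  _≤*_ : Vec ℕ m → Vec ℕ m → Set
  []       ≤* []       = ⊤
  (x ∷ xs) ≤* (y ∷ ys) = x ≤ y × xs ≤* ys

  HeadsBelow : Vec (Vec ℕ k) m → Vec ℕ m → Set
  HeadsBelow []      []      = ⊤
  HeadsBelow (w ∷ W) (x ∷ r) = head₀ w ≤ head₀ r × HeadsBelow W r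

  HeadsBelowFrom : Vec ℕ k → Vec (Vec ℕ k) m → Vec ℕ m → Set
  HeadsBelowFrom h []      []      = ⊤
  HeadsBelowFrom h (e ∷ E) (c ∷ cs) = head₀ h ≤ c × HeadsBelowFrom e E cs

  firstOr0-zipWith : (r : Vec ℕ m) (W : Vec (Vec ℕ k) m) → firstOr0 (zipWith _∷_ r W) ≡ head₀ r ∷ firstOr0 W
  firstOr0-zipWith []      []      = refl
  firstOr0-zipWith (x ∷ r) (w ∷ W) = refl

  firstOr0-∷ʳ0 : (W : Vec (Vec ℕ k) m) → firstOr0 (W ∷ʳ zeros k) ≡ firstOr0 W
  firstOr0-∷ʳ0 []      = refl
  firstOr0-∷ʳ0 (w ∷ W) = refl

  DescendingTo0-zipWith⁻ : (r : Vec ℕ m) (W : Vec (Vec ℕ k) m) → DescendingTo0 (zipWith _∷_ r W) →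
                           Decreasing r × HeadsBelow W r × DescendingTo0 W
  DescendingTo0-zipWith⁻ []      []      _ = tt , tt , tt
  DescendingTo0-zipWith⁻ (x ∷ r) (w ∷ W) (next≺ , desc)
    with r₁≤x , w₀≤r₁ , W₁≺w ← subst (_≺ (x ∷ w)) (firstOr0-zipWith r W) next≺
       | dec , below , descW ← DescendingTo0-zipWith⁻ r W desc =
    (r₁≤x , dec) , (w₀≤r₁ , below) , (W₁≺w , descW)

  DescendingTo0-zipWith⁺ : (r : Vec ℕ m) (W : Vec (Vec ℕ k) m) →
                           Decreasing r → HeadsBelow W r → DescendingTo0 W → DescendingTo0 (zipWith _∷_ r W)
  DescendingTo0-zipWith⁺ []      []      _ _ _ = tt
  DescendingTo0-zipWith⁺ (x ∷ r) (w ∷ W) (r₁≤x , dec) (w₀≤r₁ , below) (W₁≺w , descW) =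
    subst (_≺ (x ∷ w)) (sym (firstOr0-zipWith r W)) (r₁≤x , w₀≤r₁ , W₁≺w) ,
    DescendingTo0-zipWith⁺ r W dec below descW

  DescendingFrom-zipWith⁻ : (x : ℕ) (h : Vec ℕ k) (cs : Vec ℕ m) (E : Vec (Vec ℕ k) m) →
                            DescendingFrom (x ∷ h) (zipWith _∷_ cs E) →
                            Decreasing (x ∷ cs) × HeadsBelowFrom h E cs × DescendingFrom h E
  DescendingFrom-zipWith⁻ x h []       []      _ = (z≤n , tt) , tt , tt
  DescendingFrom-zipWith⁻ x h (c ∷ cs) (e ∷ E) ((c≤x , h₀≤c , e≺h) , desc)
    with dec , below , descE ← DescendingFrom-zipWith⁻ c e cs E desc =
    (c≤x , dec) , (h₀≤c , below) , (e≺h , descE)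

  DescendingFrom-zipWith⁺ : (x : ℕ) (h : Vec ℕ k) (cs : Vec ℕ m) (E : Vec (Vec ℕ k) m) →
                            Decreasing (x ∷ cs) → HeadsBelowFrom h E cs → DescendingFrom h E →
                            DescendingFrom (x ∷ h) (zipWith _∷_ cs E)
  DescendingFrom-zipWith⁺ x h []       []      _           _               _             = tt
  DescendingFrom-zipWith⁺ x h (c ∷ cs) (e ∷ E) (c≤x , dec) (h₀≤c , below) (e≺h , descE) =
    (c≤x , h₀≤c , e≺h) , DescendingFrom-zipWith⁺ c e cs E dec below descE

  head₀-zeros : ∀ k → head₀ (zeros k) ≤ 0
  head₀-zeros zero    = z≤n
  head₀-zeros (suc k) = z≤n

  0≺-head₀≤0 : (v : Vec ℕ k) → zeros k ≺ v → head₀ v ≤ 0 → v ≡ zeros k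
  0≺-head₀≤0 []          _                 _ = refl
  0≺-head₀≤0 (zero ∷ v) (_ , v₀≤0 , 0≺v) _ = cong (0 ∷_) (0≺-head₀≤0 v 0≺v v₀≤0)

  DescendingTo0-∷ʳ0⁻ : (W : Vec (Vec ℕ k) m) → DescendingTo0 (W ∷ʳ zeros k) → DescendingTo0 W
  DescendingTo0-∷ʳ0⁻ []      _              = tt
  DescendingTo0-∷ʳ0⁻ (w ∷ W) (next≺ , desc) = subst (_≺ w) (firstOr0-∷ʳ0 W) next≺ , DescendingTo0-∷ʳ0⁻ W desc

  DescendingTo0-∷ʳ0⁺ : (W : Vec (Vec ℕ k) m) → DescendingTo0 W → DescendingTo0 (W ∷ʳ zeros k)
  DescendingTo0-∷ʳ0⁺ []      _              = 0≺0 , tt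
  DescendingTo0-∷ʳ0⁺ (w ∷ W) (next≺ , desc) = subst (_≺ w) (sym (firstOr0-∷ʳ0 W)) next≺ , DescendingTo0-∷ʳ0⁺ W desc

  HeadsBelow-∷ʳ0⁻ : (W : Vec (Vec ℕ k) m) (r : Vec ℕ (suc m)) → HeadsBelow (W ∷ʳ zeros k) r → map head₀ W ≤* tail r
  HeadsBelow-∷ʳ0⁻ []      (x ∷ [])     _               = tt
  HeadsBelow-∷ʳ0⁻ (w ∷ W) (x ∷ y ∷ r) (w₀≤y , below) = w₀≤y , HeadsBelow-∷ʳ0⁻ W (y ∷ r) below

  HeadsBelow-∷ʳ0⁺ : (W : Vec (Vec ℕ k) m) (r : Vec ℕ (suc m)) → map head₀ W ≤* tail r → HeadsBelow (W ∷ʳ zeros k) r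
  HeadsBelow-∷ʳ0⁺ {k} []      (x ∷ [])     _          = head₀-zeros k , tt
  HeadsBelow-∷ʳ0⁺     (w ∷ W) (x ∷ y ∷ r) (w₀≤y , ≤*) = w₀≤y , HeadsBelow-∷ʳ0⁺ W (y ∷ r) ≤*

  Decreasing-∷ʳ0⁻ : (x : ℕ) (c : Vec ℕ m) → Decreasing (x ∷ (c ∷ʳ 0)) → Decreasing (x ∷ c)
  Decreasing-∷ʳ0⁻ x []       _             = z≤n , tt
  Decreasing-∷ʳ0⁻ x (c ∷ cs) (c≤x , dec) = c≤x , Decreasing-∷ʳ0⁻ c cs dec

  Decreasing-∷ʳ0⁺ : (x : ℕ) (c : Vec ℕ m) → Decreasing (x ∷ c) → Decreasing (x ∷ (c ∷ʳ 0))
  Decreasing-∷ʳ0⁺ x []       _             = z≤n , z≤n , tt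
  Decreasing-∷ʳ0⁺ x (c ∷ cs) (c≤x , dec) = c≤x , Decreasing-∷ʳ0⁺ c cs dec

  HeadsBelowFrom-∷ʳ0⁻ : (h : Vec ℕ k) (E : Vec (Vec ℕ k) m) (c : Vec ℕ m) →
                        HeadsBelowFrom h (E ∷ʳ zeros k) (c ∷ʳ 0) → HeadsBelowFrom h E c × head₀ (lastOr h E) ≤ 0
  HeadsBelowFrom-∷ʳ0⁻ h []      []       (h₀≤0 , _)    = tt , h₀≤0
  HeadsBelowFrom-∷ʳ0⁻ h (e ∷ E) (c ∷ cs) (h₀≤c , below) with below′ , last≤0 ← HeadsBelowFrom-∷ʳ0⁻ e E cs below =
    (h₀≤c , below′) , last≤0

  HeadsBelowFrom-∷ʳ0⁺ : (h : Vec ℕ k) (E : Vec (Vec ℕ k) m) (c : Vec ℕ m) →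
                        HeadsBelowFrom h E c → head₀ (lastOr h E) ≤ 0 → HeadsBelowFrom h (E ∷ʳ zeros k) (c ∷ʳ 0)
  HeadsBelowFrom-∷ʳ0⁺ h []      []       _               last≤0 = last≤0 , tt
  HeadsBelowFrom-∷ʳ0⁺ h (e ∷ E) (c ∷ cs) (h₀≤c , below) last≤0 = h₀≤c , HeadsBelowFrom-∷ʳ0⁺ e E cs below last≤0

  DescendingFrom-∷ʳ0⁻ : (h : Vec ℕ k) (E : Vec (Vec ℕ k) m) →
                        DescendingFrom h (E ∷ʳ zeros k) → DescendingFrom h E × zeros k ≺ lastOr h E
  DescendingFrom-∷ʳ0⁻ h []      (0≺h , _)    = tt , 0≺h
  DescendingFrom-∷ʳ0⁻ h (e ∷ E) (e≺h , desc) with desc′ , 0≺last ← DescendingFrom-∷ʳ0⁻ e E desc =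
    (e≺h , desc′) , 0≺last

  DescendingFrom-∷ʳ0⁺ : (h : Vec ℕ k) (E : Vec (Vec ℕ k) m) →
                        DescendingFrom h E → zeros k ≺ lastOr h E → DescendingFrom h (E ∷ʳ zeros k)
  DescendingFrom-∷ʳ0⁺ h []      _            0≺last = 0≺last , tt
  DescendingFrom-∷ʳ0⁺ h (e ∷ E) (e≺h , desc) 0≺last = e≺h , DescendingFrom-∷ʳ0⁺ e E desc 0≺last

  lastOr-zipWith-∷ʳ0 : (y : Vec ℕ (suc k)) (c : Vec ℕ m) (E : Vec (Vec ℕ k) m) →
                       lastOr y (zipWith _∷_ (c ∷ʳ 0) (E ∷ʳ zeros k)) ≡ zeros (suc k)
  lastOr-zipWith-∷ʳ0 y []       []      = refl
  lastOr-zipWith-∷ʳ0 y (c ∷ cs) (e ∷ E) = lastOr-zipWith-∷ʳ0 (c ∷ e) cs E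

  Hook : Vec ℕ (suc m) → Vec ℕ m → Vec (Vec ℕ k) m → Vec (Vec ℕ k) m → Set
  Hook r c W E = Decreasing r × map head₀ W ≤* tail r × Decreasing (head r ∷ c) × HeadsBelowFrom (firstOr0 W) E c

  Sliced-hook⁻ : (r : Vec ℕ (suc m)) (c : Vec ℕ m) (W E : Vec (Vec ℕ k) m) →
                 Sliced (zipWith _∷_ r (W ∷ʳ zeros k)) (zipWith _∷_ (c ∷ʳ 0) (E ∷ʳ zeros k)) → Hook r c W E × Sliced W E
  Sliced-hook⁻ {k = k} (x ∷ rs) c W E (descU , descL , _)
    with decR , belowR , descW ← DescendingTo0-zipWith⁻ (x ∷ rs) (W ∷ʳ zeros k) descU
       | decC , belowC , descE ← DescendingFrom-zipWith⁻ x (firstOr0 W) (c ∷ʳ 0) (E ∷ʳ zeros k)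
           (subst (λ h → DescendingFrom h _) (trans (firstOr0-zipWith (x ∷ rs) (W ∷ʳ zeros k)) (cong (x ∷_) (firstOr0-∷ʳ0 W))) descL)
    with belowC′ , last≤0 ← HeadsBelowFrom-∷ʳ0⁻ (firstOr0 W) E c belowC
       | descE′ , 0≺last ← DescendingFrom-∷ʳ0⁻ (firstOr0 W) E descE =
    (decR , HeadsBelow-∷ʳ0⁻ W (x ∷ rs) belowR , Decreasing-∷ʳ0⁻ x c decC , belowC′) ,
    (DescendingTo0-∷ʳ0⁻ W descW , descE′ , 0≺-head₀≤0 _ 0≺last last≤0)

  Sliced-hook⁺ : (r : Vec ℕ (suc m)) (c : Vec ℕ m) (W E : Vec (Vec ℕ k) m) →
                 Hook r c W E → Sliced W E → Sliced (zipWith _∷_ r (W ∷ʳ zeros k)) (zipWith _∷_ (c ∷ʳ 0) (E ∷ʳ zeros k))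
  Sliced-hook⁺ {k = k} (x ∷ rs) c W E (decR , belowR , decC , belowC) (descW , descE , last≡0) =
    DescendingTo0-zipWith⁺ (x ∷ rs) (W ∷ʳ zeros k) decR (HeadsBelow-∷ʳ0⁺ W (x ∷ rs) belowR) (DescendingTo0-∷ʳ0⁺ W descW) ,
    subst (λ h → DescendingFrom h _) (sym (trans (firstOr0-zipWith (x ∷ rs) (W ∷ʳ zeros k)) (cong (x ∷_) (firstOr0-∷ʳ0 W))))
      (DescendingFrom-zipWith⁺ x (firstOr0 W) (c ∷ʳ 0) (E ∷ʳ zeros k) (Decreasing-∷ʳ0⁺ x c decC)
        (HeadsBelowFrom-∷ʳ0⁺ (firstOr0 W) E c belowC (subst (λ v → head₀ v ≤ 0) (sym last≡0) (head₀-zeros k)))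
        (DescendingFrom-∷ʳ0⁺ (firstOr0 W) E descE (subst (zeros k ≺_) (sym last≡0) 0≺0))) ,
    lastOr-zipWith-∷ʳ0 _ c E

  topRow : Array m → Vec ℕ m
  topRow {zero}  []      = []
  topRow {suc m} (r ∷ _) = r

  leftCol : Array m → Vec ℕ m
  leftCol {zero}  []   = []
  leftCol {suc m} rows = map head rows

  HookMonotone : Array m → Set
  HookMonotone {zero}  []         = ⊤
  HookMonotone {suc m} (r ∷ rows) =
    Decreasing r × Decreasing (head r ∷ map head rows) ×
    topRow (map tail rows) ≤* tail r × leftCol (map tail rows) ≤* map head rows × HookMonotone (map tail rows)

  map-head₀-upper : (a : Array m) → map head₀ (upper a) ≡ topRow a
  map-head₀-upper {zero}  []         = refl
  map-head₀-upper {suc m} (r ∷ rows) = go r _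
    where
    go : ∀ {j} (xs : Vec ℕ j) (ys : Vec (Vec ℕ (suc m)) j) → map head₀ (zipWith _∷_ xs ys) ≡ xs
    go []       []       = refl
    go (x ∷ xs) (y ∷ ys) = cong (x ∷_) (go xs ys)

  HeadsBelowFrom-zipWith-∷ʳ⁻ : (h : Vec ℕ (suc k)) (xs : Vec ℕ m) (x : ℕ) (ys : Vec (Vec ℕ k) (suc m)) (c : Vec ℕ (suc m)) →
                               HeadsBelowFrom h (zipWith _∷_ (xs ∷ʳ x) ys) c → (head₀ h ∷ xs) ≤* c
  HeadsBelowFrom-zipWith-∷ʳ⁻ h []        x (y ∷ [])     (c₀ ∷ [])     (h₀≤c₀ , _)     = h₀≤c₀ , tt
  HeadsBelowFrom-zipWith-∷ʳ⁻ h (x′ ∷ xs) x (y ∷ ys@(_ ∷ _)) (c₀ ∷ c@(_ ∷ _)) (h₀≤c₀ , below) =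
    h₀≤c₀ , HeadsBelowFrom-zipWith-∷ʳ⁻ (x′ ∷ y) xs x ys c below

  HeadsBelowFrom-zipWith-∷ʳ⁺ : (h : Vec ℕ (suc k)) (xs : Vec ℕ m) (x : ℕ) (ys : Vec (Vec ℕ k) (suc m)) (c : Vec ℕ (suc m)) →
                               (head₀ h ∷ xs) ≤* c → HeadsBelowFrom h (zipWith _∷_ (xs ∷ʳ x) ys) c
  HeadsBelowFrom-zipWith-∷ʳ⁺ h []        x (y ∷ [])     (c₀ ∷ [])     (h₀≤c₀ , _)   = h₀≤c₀ , tt
  HeadsBelowFrom-zipWith-∷ʳ⁺ h (x′ ∷ xs) x (y ∷ ys@(_ ∷ _)) (c₀ ∷ c@(_ ∷ _)) (h₀≤c₀ , ≤*) =
    h₀≤c₀ , HeadsBelowFrom-zipWith-∷ʳ⁺ (x′ ∷ y) xs x ys c ≤*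

  HeadsBelowFrom-lower⁻ : (a : Array m) (c : Vec ℕ m) → HeadsBelowFrom (firstOr0 (upper a)) (lower a) c → leftCol a ≤* c
  HeadsBelowFrom-lower⁻ {zero}  []               []  _     = tt
  HeadsBelowFrom-lower⁻ {suc m} ((x ∷ r) ∷ rows) c below =
    HeadsBelowFrom-zipWith-∷ʳ⁻ (x ∷ _) (map head rows) 0 _ c
      (subst (λ h → HeadsBelowFrom h (lower ((x ∷ r) ∷ rows)) c)
             (firstOr0-zipWith (x ∷ r) (upper (map tail rows) ∷ʳ zeros (suc m))) below)

  HeadsBelowFrom-lower⁺ : (a : Array m) (c : Vec ℕ m) → leftCol a ≤* c → HeadsBelowFrom (firstOr0 (upper a)) (lower a) c
  HeadsBelowFrom-lower⁺ {zero}  []               []  _  = tt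
  HeadsBelowFrom-lower⁺ {suc m} ((x ∷ r) ∷ rows) c ≤* =
    subst (λ h → HeadsBelowFrom h (lower ((x ∷ r) ∷ rows)) c)
          (sym (firstOr0-zipWith (x ∷ r) (upper (map tail rows) ∷ʳ zeros (suc m))))
      (HeadsBelowFrom-zipWith-∷ʳ⁺ (x ∷ _) (map head rows) 0 _ c ≤*)

  Sliced-upper-lower⁻ : (a : Array m) → Sliced (upper a) (lower a) → HookMonotone a
  Sliced-upper-lower⁻ {zero}  []         _      = tt
  Sliced-upper-lower⁻ {suc m} (r ∷ rows) sliced
    with (decR , belowR , decC , belowC) , sliced′ ←
         Sliced-hook⁻ r (map head rows) (upper (map tail rows)) (lower (map tail rows)) sliced =
    decR , decC , subst (_≤* tail r) (map-head₀-upper (map tail rows)) belowR ,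
    HeadsBelowFrom-lower⁻ (map tail rows) (map head rows) belowC , Sliced-upper-lower⁻ (map tail rows) sliced′

  Sliced-upper-lower⁺ : (a : Array m) → HookMonotone a → Sliced (upper a) (lower a)
  Sliced-upper-lower⁺ {zero}  []         _ = tt , tt , refl
  Sliced-upper-lower⁺ {suc m} (r ∷ rows) (decR , decC , top≤ , left≤ , mono) =
    Sliced-hook⁺ r (map head rows) (upper (map tail rows)) (lower (map tail rows))
      (decR , subst (_≤* tail r) (sym (map-head₀-upper (map tail rows))) top≤ , decC ,
       HeadsBelowFrom-lower⁺ (map tail rows) (map head rows) left≤)
      (Sliced-upper-lower⁺ (map tail rows) mono)

  lastOr-∷ʳ : (h : A) (xs : Vec A m) (y : A) → lastOr h (xs ∷ʳ y) ≡ y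
  lastOr-∷ʳ h []       y = refl
  lastOr-∷ʳ h (x ∷ xs) y = lastOr-∷ʳ x xs y

  lastOr-map : {B : Set} (f : A → B) (h : A) (xs : Vec A m) → lastOr (f h) (map f xs) ≡ f (lastOr h xs)
  lastOr-map f h []       = refl
  lastOr-map f h (x ∷ xs) = lastOr-map f x xs

  init∷ʳlastOr : (h : A) (v : Vec A (suc m)) → init v ∷ʳ lastOr h v ≡ v
  init∷ʳlastOr h v = sym (trans v≡init∷ʳlast (cong (init v ∷ʳ_)
    (sym (trans (cong (lastOr h) v≡init∷ʳlast) (lastOr-∷ʳ h (init v) (last v))))))
    where v≡init∷ʳlast = proj₂ (proj₂ (initLast v))

  DescendingTo0-last : (U : Vec (Vec ℕ k) m) → DescendingTo0 U → zeros k ≺ lastOr (zeros k) U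
  DescendingTo0-last []           _          = 0≺0
  DescendingTo0-last (u ∷ [])     (0≺u , _)  = 0≺u
  DescendingTo0-last (u ∷ u′ ∷ U) (_ , desc) = DescendingTo0-last (u′ ∷ U) desc

  tail≡0 : (v : Vec ℕ (suc k)) → zeros (suc k) ≺ v → tail v ≡ zeros k
  tail≡0 (x ∷ v) (_ , v₀≤0 , 0≺v) = 0≺-head₀≤0 v 0≺v v₀≤0

  upper-shape : (U : Vec (Vec ℕ (suc k)) (suc m)) → DescendingTo0 U →
                U ≡ zipWith _∷_ (map head U) (init (map tail U) ∷ʳ zeros k)
  upper-shape {k} U desc = begin
    U
      ≡⟨ zipWith-head-tail U ⟨
    zipWith _∷_ (map head U) (map tail U)
      ≡⟨ cong (zipWith _∷_ (map head U)) (init∷ʳlastOr (zeros k) (map tail U)) ⟨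
    zipWith _∷_ (map head U) (init (map tail U) ∷ʳ lastOr (zeros k) (map tail U))
      ≡⟨ cong (λ v → zipWith _∷_ (map head U) (init (map tail U) ∷ʳ v))
           (trans (lastOr-map tail (zeros (suc k)) U) (tail≡0 _ (DescendingTo0-last U desc))) ⟩
    zipWith _∷_ (map head U) (init (map tail U) ∷ʳ zeros k) ∎
    where open ≡-Reasoning

  lower-shape : (h : Vec ℕ (suc k)) (L : Vec (Vec ℕ (suc k)) (suc m)) → lastOr h L ≡ zeros (suc k) →
                L ≡ zipWith _∷_ (init (map head L) ∷ʳ 0) (init (map tail L) ∷ʳ zeros k)
  lower-shape {k} h L last≡0 = begin
    L
      ≡⟨ zipWith-head-tail L ⟨
    zipWith _∷_ (map head L) (map tail L)
      ≡⟨ cong₂ (zipWith _∷_) (init∷ʳlastOr (head h) (map head L)) (init∷ʳlastOr (tail h) (map tail L)) ⟨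
    zipWith _∷_ (init (map head L) ∷ʳ lastOr (head h) (map head L)) (init (map tail L) ∷ʳ lastOr (tail h) (map tail L))
      ≡⟨ cong₂ (λ x v → zipWith _∷_ (init (map head L) ∷ʳ x) (init (map tail L) ∷ʳ v))
           (trans (lastOr-map head h L) (cong head last≡0)) (trans (lastOr-map tail h L) (cong tail last≡0)) ⟩
    zipWith _∷_ (init (map head L) ∷ʳ 0) (init (map tail L) ∷ʳ zeros k) ∎
    where open ≡-Reasoning

  upper-lower-glue : (U L : Vec (Vec ℕ (suc m)) m) → Sliced U L → upper (glue U L) ≡ U × lower (glue U L) ≡ L
  upper-lower-glue {zero}  []  []  _ = refl , refl
  upper-lower-glue {suc m} U L sliced@(descU , _ , last≡0) = upper≡ , lower≡
    where
    r = map head U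
    c = init (map head L)
    W = init (map tail U)
    E = init (map tail L)
    U≡ : U ≡ zipWith _∷_ r (W ∷ʳ zeros (suc m))
    U≡ = upper-shape U descU
    L≡ : L ≡ zipWith _∷_ (c ∷ʳ 0) (E ∷ʳ zeros (suc m))
    L≡ = lower-shape (firstOr0 U) L last≡0
    ih : upper (glue W E) ≡ W × lower (glue W E) ≡ E
    ih = upper-lower-glue W E (proj₂ (Sliced-hook⁻ r c W E (subst₂ Sliced U≡ L≡ sliced)))
    upper≡ : upper (glue U L) ≡ U
    upper≡ = trans (cong (λ a → zipWith _∷_ r (upper a ∷ʳ zeros (suc m))) (map-tail-zipWith c (glue W E)))
      (trans (cong (λ V → zipWith _∷_ r (V ∷ʳ zeros (suc m))) (proj₁ ih)) (sym U≡))
    lower≡ : lower (glue U L) ≡ L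
    lower≡ = trans (cong₂ (λ x a → zipWith _∷_ (x ∷ʳ 0) (lower a ∷ʳ zeros (suc m)))
                          (map-head-zipWith c (glue W E)) (map-tail-zipWith c (glue W E)))
      (trans (cong (λ V → zipWith _∷_ (c ∷ʳ 0) (V ∷ʳ zeros (suc m))) (proj₂ ih)) (sym L≡))

  total : Vec (Vec ℕ k) m → ℕ
  total V = sum (map sum V)

  sum-∷ʳ0 : (c : Vec ℕ m) → sum (c ∷ʳ 0) ≡ sum c
  sum-∷ʳ0 []      = refl
  sum-∷ʳ0 (x ∷ c) = cong (x +_) (sum-∷ʳ0 c)

  total-∷ʳ : (W : Vec (Vec ℕ k) m) (v : Vec ℕ k) → total (W ∷ʳ v) ≡ total W + sum v
  total-∷ʳ []      v = +-identityʳ (sum v)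
  total-∷ʳ (w ∷ W) v = trans (cong (sum w +_) (total-∷ʳ W v)) (sym (+-assoc (sum w) (total W) (sum v)))

  total-∷ʳ0 : (W : Vec (Vec ℕ k) m) → total (W ∷ʳ zeros k) ≡ total W
  total-∷ʳ0 {k} W = trans (total-∷ʳ W (zeros k)) (trans (cong (total W +_) (sum-replicate-0 k)) (+-identityʳ (total W)))

  total-zipWith : (xs : Vec ℕ m) (ys : Vec (Vec ℕ k) m) → total (zipWith _∷_ xs ys) ≡ sum xs + total ys
  total-zipWith []       []       = refl
  total-zipWith (x ∷ xs) (y ∷ ys) = trans (cong (x + sum y +_) (total-zipWith xs ys))
    (solve 4 (λ x y s t → (x :+ y) :+ (s :+ t) := (x :+ s) :+ (y :+ t)) refl x (sum y) (sum xs) (total ys))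

  total-upper-lower : (a : Array m) → total a ≡ total (upper a) + total (lower a)
  total-upper-lower {zero}  []         = refl
  total-upper-lower {suc m} (r ∷ rows) = begin
    sum r + total rows
      ≡⟨ cong (λ rs → sum r + total rs) (zipWith-head-tail rows) ⟨
    sum r + total (zipWith _∷_ (map head rows) (map tail rows))
      ≡⟨ cong (sum r +_) (total-zipWith (map head rows) (map tail rows)) ⟩
    sum r + (sum (map head rows) + total (map tail rows))
      ≡⟨ cong (λ t → sum r + (sum (map head rows) + t)) (total-upper-lower (map tail rows)) ⟩
    sum r + (sum (map head rows) + (total U′ + total L′))
      ≡⟨ solve 4 (λ r c u l → r :+ (c :+ (u :+ l)) := (r :+ u) :+ (c :+ l)) refl
                 (sum r) (sum (map head rows)) (total U′) (total L′) ⟩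
    (sum r + total U′) + (sum (map head rows) + total L′)
      ≡⟨ cong₂ _+_ (trans (total-zipWith r _) (cong (sum r +_) (total-∷ʳ0 U′)))
                   (trans (total-zipWith (map head rows ∷ʳ 0) (L′ ∷ʳ zeros (suc m)))
                          (cong₂ _+_ (sum-∷ʳ0 (map head rows)) (total-∷ʳ0 L′))) ⟨
    total (upper (r ∷ rows)) + total (lower (r ∷ rows)) ∎
    where
    open ≡-Reasoning
    U′ = upper (map tail rows)
    L′ = lower (map tail rows)

  AscendingFrom : Vec ℕ k → Vec (Vec ℕ k) m → Set
  AscendingFrom x []       = ⊤
  AscendingFrom x (v ∷ vs) = x ≺ v × AscendingFrom v vs

  AscendingFrom-∷ʳ⁻ : (x : Vec ℕ k) (vs : Vec (Vec ℕ k) m) (v : Vec ℕ k) →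
                      AscendingFrom x (vs ∷ʳ v) → AscendingFrom x vs × lastOr x vs ≺ v
  AscendingFrom-∷ʳ⁻ x []        v (x≺v , _)   = tt , x≺v
  AscendingFrom-∷ʳ⁻ x (v′ ∷ vs) v (x≺v′ , asc) with asc′ , last≺v ← AscendingFrom-∷ʳ⁻ v′ vs v asc =
    (x≺v′ , asc′) , last≺v

  AscendingFrom-∷ʳ⁺ : (x : Vec ℕ k) (vs : Vec (Vec ℕ k) m) (v : Vec ℕ k) →
                      AscendingFrom x vs → lastOr x vs ≺ v → AscendingFrom x (vs ∷ʳ v)
  AscendingFrom-∷ʳ⁺ x []        v _            last≺v = last≺v , tt
  AscendingFrom-∷ʳ⁺ x (v′ ∷ vs) v (x≺v′ , asc) last≺v = x≺v′ , AscendingFrom-∷ʳ⁺ v′ vs v asc last≺v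

  lastOr-reverse : (U : Vec (Vec ℕ k) m) → lastOr (zeros k) (reverse U) ≡ firstOr0 U
  lastOr-reverse []      = refl
  lastOr-reverse (u ∷ U) = trans (cong (lastOr (zeros _)) (reverse-∷ u U)) (lastOr-∷ʳ (zeros _) (reverse U) u)

  AscendingFrom-reverse⁻ : (U : Vec (Vec ℕ k) m) → AscendingFrom (zeros k) (reverse U) → DescendingTo0 U
  AscendingFrom-reverse⁻ []      _   = tt
  AscendingFrom-reverse⁻ (u ∷ U) asc
    with asc′ , last≺u ← AscendingFrom-∷ʳ⁻ (zeros _) (reverse U) u (subst (AscendingFrom (zeros _)) (reverse-∷ u U) asc) =
    subst (_≺ u) (lastOr-reverse U) last≺u , AscendingFrom-reverse⁻ U asc′

  AscendingFrom-reverse⁺ : (U : Vec (Vec ℕ k) m) → DescendingTo0 U → AscendingFrom (zeros k) (reverse U)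
  AscendingFrom-reverse⁺ []      _              = tt
  AscendingFrom-reverse⁺ (u ∷ U) (first≺u , desc) = subst (AscendingFrom (zeros _)) (sym (reverse-∷ u U))
    (AscendingFrom-∷ʳ⁺ (zeros _) (reverse U) u (AscendingFrom-reverse⁺ U desc) (subst (_≺ u) (sym (lastOr-reverse U)) first≺u))

  total-reverse : (U : Vec (Vec ℕ k) m) → total (reverse U) ≡ total U
  total-reverse []      = refl
  total-reverse (u ∷ U) = trans (cong total (reverse-∷ u U))
    (trans (total-∷ʳ (reverse U) u) (trans (cong (_+ sum u) (total-reverse U)) (+-comm (total U) (sum u))))

  total-++ : (V : Vec (Vec ℕ k) m) {j : ℕ} (W : Vec (Vec ℕ k) j) → total (V ++ W) ≡ total V + total W
  total-++ []      W = refl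
  total-++ (v ∷ V) W = trans (cong (sum v +_) (total-++ V W)) (sym (+-assoc (sum v) (total V) (total W)))

  sum≤total : (V : Vec (Vec ℕ k) m) → All (λ v → sum v ≤ total V) V
  sum≤total []      = []
  sum≤total (v ∷ V) = m≤m+n (sum v) (total V) ∷ All.map (λ {w} Σw≤ → ≤-trans Σw≤ (m≤n+m (total V) (sum v))) (sum≤total V)

module Monotonicity where

  open import Data.Nat hiding (zero; suc)
  open import Data.Nat as ℕ using (zero; suc)
  open import Data.Nat.Properties
  open import Data.Vec using (Vec; []; _∷_; head; tail; map; lookup)
  open import Data.Vec.Properties using (lookup-map)
  open import Data.Fin as Fin using (Fin; zero; suc)
  open import Data.Product using (_,_)
  open import Data.Unit using (tt)
  open import Function using (_∘_)
  open import Relation.Binary.PropositionalEquality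

  open import Defs using (Array; entry)
  open Slicing using (Decreasing; _≤*_; topRow; leftCol; HookMonotone)

  private variable
    m : ℕ

  Monotone : Array m → Set
  Monotone {m} a = ∀ (i i′ j j′ : Fin m) → i Fin.≤ i′ → j Fin.≤ j′ → entry a i′ j′ ≤ entry a i j

  Decreasing-lookup : (v : Vec ℕ m) → Decreasing v → ∀ (j j′ : Fin m) → j Fin.≤ j′ → lookup v j′ ≤ lookup v j
  Decreasing-lookup (x ∷ xs)     _           zero    zero     _         = ≤-refl
  Decreasing-lookup (x ∷ y ∷ ys) (y≤x , dec) zero    (suc j′) _         = ≤-trans (Decreasing-lookup (y ∷ ys) dec zero j′ z≤n) y≤x
  Decreasing-lookup (x ∷ xs)     (_ , dec)   (suc j) (suc j′) (s≤s j≤j′) = Decreasing-lookup xs dec j j′ j≤j′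

  lookup-Decreasing : (v : Vec ℕ m) → (∀ (j j′ : Fin m) → j Fin.≤ j′ → lookup v j′ ≤ lookup v j) → Decreasing v
  lookup-Decreasing []           _    = tt
  lookup-Decreasing (x ∷ [])     _    = z≤n , tt
  lookup-Decreasing (x ∷ y ∷ ys) mono =
    mono zero (suc zero) z≤n , lookup-Decreasing (y ∷ ys) (λ j j′ le → mono (suc j) (suc j′) (s≤s le))

  ≤*-lookup : {u v : Vec ℕ m} → u ≤* v → ∀ j → lookup u j ≤ lookup v j
  ≤*-lookup {u = _ ∷ _} {_ ∷ _} (x≤y , _)  zero    = x≤y
  ≤*-lookup {u = _ ∷ _} {_ ∷ _} (_ , u≤*v) (suc j) = ≤*-lookup u≤*v j

  lookup-≤* : (u v : Vec ℕ m) → (∀ j → lookup u j ≤ lookup v j) → u ≤* v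
  lookup-≤* []      []      _   = tt
  lookup-≤* (x ∷ u) (y ∷ v) u≤v = u≤v zero , lookup-≤* u v (u≤v ∘ suc)

  entry-inner : (r : Vec ℕ (suc m)) (rows : Vec (Vec ℕ (suc m)) m) (i j : Fin m) →
                entry (map tail rows) i j ≡ entry (r ∷ rows) (suc i) (suc j)
  entry-inner r rows i j with lookup rows i | lookup-map i tail rows
  ... | x ∷ row | eq = cong (λ v → lookup v j) eq

  entry-leftCol : (r : Vec ℕ (suc m)) (rows : Vec (Vec ℕ (suc m)) m) (i : Fin (suc m)) →
                  lookup (head r ∷ map head rows) i ≡ entry (r ∷ rows) i zero
  entry-leftCol (x ∷ r) rows zero    = refl
  entry-leftCol r       rows (suc i) with lookup rows i | lookup-map i head rows
  ... | x ∷ row | eq = eq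

  Monotone-inner : (r : Vec ℕ (suc m)) (rows : Vec (Vec ℕ (suc m)) m) → Monotone (r ∷ rows) → Monotone (map tail rows)
  Monotone-inner r rows mono i i′ j j′ i≤i′ j≤j′ =
    subst₂ _≤_ (sym (entry-inner r rows i′ j′)) (sym (entry-inner r rows i j))
      (mono (suc i) (suc i′) (suc j) (suc j′) (s≤s i≤i′) (s≤s j≤j′))

  topRow-lookup : (a : Array (suc m)) (j : Fin (suc m)) → lookup (topRow a) j ≡ entry a zero j
  topRow-lookup (r ∷ _) j = refl

  leftCol-lookup : (a : Array (suc m)) (i : Fin (suc m)) → lookup (leftCol a) i ≡ entry a i zero
  leftCol-lookup a i with lookup a i | lookup-map i head a
  ... | x ∷ row | eq = eq

  entry≤top : (r : Vec ℕ (suc m)) (rows : Vec (Vec ℕ (suc m)) m) → topRow (map tail rows) ≤* tail r →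
              Monotone (map tail rows) → ∀ i j → entry (r ∷ rows) (suc i) (suc j) ≤ lookup r (suc j)
  entry≤top {suc m} (x ∷ r) rows top≤ inner i j = subst (_≤ lookup r j) (entry-inner (x ∷ r) rows i j)
    (≤-trans (inner zero i j j z≤n ≤-refl) (subst (_≤ lookup r j) (topRow-lookup (map tail rows) j) (≤*-lookup top≤ j)))

  entry≤left : (r : Vec ℕ (suc m)) (rows : Vec (Vec ℕ (suc m)) m) → leftCol (map tail rows) ≤* map head rows →
               Monotone (map tail rows) → ∀ i j → entry (r ∷ rows) (suc i) (suc j) ≤ entry (r ∷ rows) (suc i) zero
  entry≤left {suc m} r rows left≤ inner i j = subst₂ _≤_ (entry-inner r rows i j) (entry-leftCol r rows (suc i))
    (≤-trans (inner i i zero j ≤-refl z≤n)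
             (subst (_≤ lookup (map head rows) i) (leftCol-lookup (map tail rows) i) (≤*-lookup left≤ i)))

  Monotone⇒top≤ : (r : Vec ℕ (suc m)) (rows : Vec (Vec ℕ (suc m)) m) → Monotone (r ∷ rows) →
                  topRow (map tail rows) ≤* tail r
  Monotone⇒top≤ {zero}  (x ∷ []) []   _    = tt
  Monotone⇒top≤ {suc m} (x ∷ r)  rows mono = lookup-≤* _ _ (λ j →
    subst (_≤ lookup r j) (sym (trans (topRow-lookup (map tail rows) j) (entry-inner (x ∷ r) rows zero j)))
      (mono zero (suc zero) (suc j) (suc j) z≤n ≤-refl))

  Monotone⇒left≤ : (r : Vec ℕ (suc m)) (rows : Vec (Vec ℕ (suc m)) m) → Monotone (r ∷ rows) →
                   leftCol (map tail rows) ≤* map head rows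
  Monotone⇒left≤ {zero}  r []   _    = tt
  Monotone⇒left≤ {suc m} r rows mono = lookup-≤* _ _ (λ i →
    subst₂ _≤_ (sym (trans (leftCol-lookup (map tail rows) i) (entry-inner r rows i zero))) (sym (entry-leftCol r rows (suc i)))
      (mono (suc i) (suc i) zero (suc zero) ≤-refl z≤n))

  Monotone⇒HookMonotone : (a : Array m) → Monotone a → HookMonotone a
  Monotone⇒HookMonotone {zero}  []         _    = tt
  Monotone⇒HookMonotone {suc m} (r ∷ rows) mono =
    lookup-Decreasing r (λ j j′ j≤j′ → mono zero zero j j′ z≤n j≤j′) ,
    lookup-Decreasing (head r ∷ map head rows)
      (λ i i′ i≤i′ → subst₂ _≤_ (sym (entry-leftCol r rows i′)) (sym (entry-leftCol r rows i)) (mono i i′ zero zero i≤i′ z≤n)) ,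
    Monotone⇒top≤ r rows mono , Monotone⇒left≤ r rows mono ,
    Monotone⇒HookMonotone (map tail rows) (Monotone-inner r rows mono)

  HookMonotone⇒Monotone : (a : Array m) → HookMonotone a → Monotone a
  HookMonotone⇒Monotone {suc m} (r ∷ rows) (decR , decC , top≤ , left≤ , hook) = mono
    where
    inner : Monotone (map tail rows)
    inner = HookMonotone⇒Monotone (map tail rows) hook
    column : ∀ (i i′ : Fin (suc m)) → i Fin.≤ i′ → entry (r ∷ rows) i′ zero ≤ entry (r ∷ rows) i zero
    column i i′ i≤i′ = subst₂ _≤_ (entry-leftCol r rows i′) (entry-leftCol r rows i)
      (Decreasing-lookup (head r ∷ map head rows) decC i i′ i≤i′)
    mono : Monotone (r ∷ rows)
    mono zero     zero     j        j′       _     j≤j′ = Decreasing-lookup r decR j j′ j≤j′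
    mono (suc i)  zero     _        _        ()    _
    mono i        i′       zero     zero     i≤i′  _    = column i i′ i≤i′
    mono i        i′       (suc j)  zero     _     ()
    mono zero     (suc i′) j        (suc j′) _     j≤j′ =
      ≤-trans (entry≤top r rows top≤ inner i′ j′) (Decreasing-lookup r decR j (suc j′) j≤j′)
    mono (suc i)  (suc i′) zero     (suc j′) i≤i′  _    =
      ≤-trans (entry≤left r rows left≤ inner i′ j′) (column (suc i) (suc i′) i≤i′)
    mono (suc i)  (suc i′) (suc j)  (suc j′) (s≤s i≤i′) (s≤s j≤j′) =
      subst₂ _≤_ (entry-inner r rows i′ j′) (entry-inner r rows i j) (inner i i′ j j′ i≤i′ j≤j′)

module Walks (n : ℕ) where

  open import Data.Nat
  open import Data.Nat.Properties
  open import Data.Nat.Solver using (module +-*-Solver)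
  open import Data.List using (List; []; _∷_; _++_; map; length; upTo; applyUpTo; applyDownFrom)
  open import Data.List.Properties using (++-identityʳ; length-++; length-map; length-applyDownFrom; length-upTo)
  open import Data.Vec using (Vec; []; _∷_; sum; toList; reverse) renaming (_++_ to _++ᵥ_)
  open import Data.Vec.Properties using (toList-++)
  open import Data.Product using (_×_; _,_; proj₁; proj₂)
  open import Data.Empty using (⊥)
  open import Data.Unit using (⊤; tt)
  open import Relation.Nullary using (Dec; no)
  open import Relation.Nullary.Decidable using (_×-dec_)
  open import Relation.Binary.PropositionalEquality
  open import Function using (id; _∘′_)
  open +-*-Solver using (solve; _:+_; _:=_)

  open Sums
  open BoundedVectors
  open Interlacing
  open Slicing
    using (lastOr; total; total-reverse; lastOr-reverse; Sliced; AscendingFrom; DescendingFrom;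
           AscendingFrom-reverse⁻; AscendingFrom-reverse⁺)
  open Transfer n

  private variable
    m : ℕ

  IsWalk : Slice → List Step → ℕ → List Slice → Set
  IsWalk α []      acc []       = α ≡ empty × acc ≡ n
  IsWalk α (s ∷ w) acc (β ∷ βs) = Adjacent s α β × IsWalk β w (acc + gain s α β) βs
  IsWalk α []      acc (_ ∷ _)  = ⊥
  IsWalk α (_ ∷ _) acc []       = ⊥

  isWalk? : ∀ α w acc βs → Dec (IsWalk α w acc βs)
  isWalk? α []      acc []       = α ≟ₛ empty ×-dec acc ≟ n
  isWalk? α (s ∷ w) acc (β ∷ βs) = adjacent? s α β ×-dec isWalk? β w (acc + gain s α β) βs
  isWalk? α []      acc (_ ∷ _)  = no λ ()
  isWalk? α (_ ∷ _) acc []       = no λ ()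

  #walks≡∑ : ∀ α w acc → length w ≡ m → #walks α w acc ≡ ∑[ βs ← vecsOver slices m ] [ isWalk? α w acc (toList βs) ]· 1
  #walks≡∑ α []      acc refl = sym (trans (+-identityʳ _) (sym ([]·-× (α ≟ₛ empty) (acc ≟ n) 1)))
  #walks≡∑ {suc m} α (s ∷ w) acc |w|≡m = begin
    ∑[ β ← slices ] [ adjacent? s α β ]· #walks β w (acc + gain s α β)
      ≡⟨ ∑-cong slices (λ β → cong [ adjacent? s α β ]·_ (#walks≡∑ β w _ (suc-injective |w|≡m))) ⟩
    ∑[ β ← slices ] [ adjacent? s α β ]· ∑[ βs ← vecsOver slices m ] [ isWalk? β w (acc + gain s α β) (toList βs) ]· 1
      ≡⟨ ∑-cong slices (λ β → trans ([]·-∑ (adjacent? s α β) (vecsOver slices m) _)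
           (∑-cong (vecsOver slices m) (λ βs → []·-× (adjacent? s α β) _ 1))) ⟩
    ∑[ β ← slices ] ∑[ βs ← vecsOver slices m ] [ isWalk? α (s ∷ w) acc (toList (β ∷ βs)) ]· 1
      ≡⟨ ∑-cartesianProductWith _∷_ slices (vecsOver slices m) _ ⟨
    ∑[ βs ← vecsOver slices (suc m) ] [ isWalk? α (s ∷ w) acc (toList βs) ]· 1 ∎
    where open ≡-Reasoning

  Path : Slice → List Step → List Slice → Set
  Path α []      []       = ⊤
  Path α (s ∷ w) (β ∷ βs) = Adjacent s α β × Path β w βs
  Path α []      (_ ∷ _)  = ⊥
  Path α (_ ∷ _) []       = ⊥

  finalAcc : Slice → List Step → ℕ → List Slice → ℕ
  finalAcc α []      acc βs       = acc
  finalAcc α (s ∷ w) acc []       = acc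
  finalAcc α (s ∷ w) acc (β ∷ βs) = finalAcc β w (acc + gain s α β) βs

  IsWalk-++⁻ : ∀ α w₁ w₂ acc (xs : Vec Slice m) βs → length w₁ ≡ m → IsWalk α (w₁ ++ w₂) acc (toList xs ++ βs) →
               Path α w₁ (toList xs) × IsWalk (lastOr α xs) w₂ (finalAcc α w₁ acc (toList xs)) βs
  IsWalk-++⁻ α []       w₂ acc []       βs _       walk           = tt , walk
  IsWalk-++⁻ α (s ∷ w₁) w₂ acc (x ∷ xs) βs |w₁|≡m (adj , walk) =
    let path , rest = IsWalk-++⁻ x w₁ w₂ _ xs βs (suc-injective |w₁|≡m) walk in (adj , path) , rest

  IsWalk-++⁺ : ∀ α w₁ w₂ acc (xs : Vec Slice m) βs → Path α w₁ (toList xs) →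
               IsWalk (lastOr α xs) w₂ (finalAcc α w₁ acc (toList xs)) βs → IsWalk α (w₁ ++ w₂) acc (toList xs ++ βs)
  IsWalk-++⁺ α []       w₂ acc []       βs _            walk = walk
  IsWalk-++⁺ α (s ∷ w₁) w₂ acc (x ∷ xs) βs (adj , path) walk = adj , IsWalk-++⁺ x w₁ w₂ _ xs βs path walk

  Path-up⁻ : ∀ {α} as (xs : Vec Slice m) → Path α (map up as) (toList xs) → AscendingFrom α xs
  Path-up⁻ []       []       _             = tt
  Path-up⁻ (a ∷ as) (x ∷ xs) (α≺x , path) = α≺x , Path-up⁻ as xs path

  Path-up⁺ : ∀ {α} as (xs : Vec Slice m) → length as ≡ m → AscendingFrom α xs → Path α (map up as) (toList xs)
  Path-up⁺ []       []       _      _            = tt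
  Path-up⁺ (a ∷ as) (x ∷ xs) |as|≡m (α≺x , asc) = α≺x , Path-up⁺ as xs (suc-injective |as|≡m) asc

  Path-down⁻ : ∀ {α} bs (xs : Vec Slice m) → Path α (map down bs) (toList xs) → DescendingFrom α xs
  Path-down⁻ []       []       _             = tt
  Path-down⁻ (b ∷ bs) (x ∷ xs) (x≺α , path) = x≺α , Path-down⁻ bs xs path

  Path-down⁺ : ∀ {α} bs (xs : Vec Slice m) → length bs ≡ m → DescendingFrom α xs → Path α (map down bs) (toList xs)
  Path-down⁺ []       []       _      _             = tt
  Path-down⁺ (b ∷ bs) (x ∷ xs) |bs|≡m (x≺α , desc) = x≺α , Path-down⁺ bs xs (suc-injective |bs|≡m) desc

  finalAcc-up : ∀ {α} acc (xs : Vec Slice m) → AscendingFrom α xs →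
                finalAcc α (map up (applyDownFrom suc m)) acc (toList xs) + m * sum α ≡ acc + total xs
  finalAcc-up         acc []       _            = refl
  finalAcc-up {suc m} {α} acc (x ∷ xs) (α≺x , asc) = +-cancelʳ-≡ (m * Σx) _ _ (begin
    F + (Σα + m * Σα) + m * Σx
      ≡⟨ solve 4 (λ F a b c → F :+ (a :+ b) :+ c := (F :+ c) :+ (a :+ b)) refl F Σα (m * Σα) (m * Σx) ⟩
    (F + m * Σx) + (Σα + m * Σα)
      ≡⟨ cong (_+ (Σα + m * Σα)) (finalAcc-up _ xs asc) ⟩
    (acc + suc m * (Σx ∸ Σα) + total xs) + suc m * Σα
      ≡⟨ solve 4 (λ c d t a → (c :+ d :+ t) :+ a := c :+ t :+ (d :+ a)) refl acc (suc m * (Σx ∸ Σα)) (total xs) (suc m * Σα) ⟩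
    acc + total xs + (suc m * (Σx ∸ Σα) + suc m * Σα)
      ≡⟨ cong (acc + total xs +_) (trans (sym (*-distribˡ-+ (suc m) (Σx ∸ Σα) Σα)) (cong (suc m *_) (m∸n+n≡m (≺-sum α≺x)))) ⟩
    acc + total xs + suc m * Σx
      ≡⟨ solve 4 (λ c t x y → c :+ t :+ (x :+ y) := c :+ (x :+ t) :+ y) refl acc (total xs) Σx (m * Σx) ⟩
    acc + (Σx + total xs) + m * Σx ∎)
    where
    open ≡-Reasoning
    Σα = sum α
    Σx = sum x
    F = finalAcc x (map up (applyDownFrom suc m)) (acc + suc m * (Σx ∸ Σα)) (toList xs)

  finalAcc-down : ∀ {β} (f : ℕ → ℕ) → (∀ i → f (suc i) ≡ suc (f i)) → ∀ acc (xs : Vec Slice m) → DescendingFrom β xs →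
                  finalAcc β (map down (applyUpTo f m)) acc (toList xs) + f m * sum (lastOr β xs) ≡ acc + f 0 * sum β + total xs
  finalAcc-down         f f-suc acc []       _            = sym (+-identityʳ _)
  finalAcc-down {suc m} {β} f f-suc acc (x ∷ xs) (x≺β , desc) = begin
    finalAcc x (map down (applyUpTo (f ∘′ suc) m)) (acc + f 0 * (Σβ ∸ Σx)) (toList xs) + f (suc m) * sum (lastOr x xs)
      ≡⟨ finalAcc-down (f ∘′ suc) (λ i → f-suc (suc i)) _ xs desc ⟩
    acc + f 0 * (Σβ ∸ Σx) + f 1 * Σx + total xs
      ≡⟨ cong (λ y → acc + f 0 * (Σβ ∸ Σx) + y * Σx + total xs) (f-suc 0) ⟩
    acc + f 0 * (Σβ ∸ Σx) + (Σx + f 0 * Σx) + total xs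
      ≡⟨ solve 5 (λ c d x e t → c :+ d :+ (x :+ e) :+ t := c :+ (d :+ e) :+ (x :+ t)) refl
                 acc (f 0 * (Σβ ∸ Σx)) Σx (f 0 * Σx) (total xs) ⟩
    acc + (f 0 * (Σβ ∸ Σx) + f 0 * Σx) + (Σx + total xs)
      ≡⟨ cong (λ y → acc + y + (Σx + total xs))
           (trans (sym (*-distribˡ-+ (f 0) (Σβ ∸ Σx) Σx)) (cong (f 0 *_) (m∸n+n≡m (≺-sum x≺β)))) ⟩
    acc + f 0 * Σβ + (Σx + total xs) ∎
    where
    open ≡-Reasoning
    Σβ = sum β
    Σx = sum x

  -- Up-weights n, …, 1 and down-weights 0, …, n - 1 make the total gain of a walk the total
  -- size of its slices (finalAcc-up, finalAcc-down).
  boxWord : List Step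
  boxWord = map up (applyDownFrom suc n) ++ map down (upTo n)

  length-boxWord : length boxWord ≡ n + n
  length-boxWord = trans (length-++ (map up (applyDownFrom suc n)))
    (cong₂ _+_ (trans (length-map up (applyDownFrom suc n)) (length-applyDownFrom suc n))
               (trans (length-map down (upTo n)) (length-upTo n)))

  private
    ups = applyDownFrom suc n
    downs = upTo n

    |ups| : length (map up ups) ≡ n
    |ups| = trans (length-map up ups) (length-applyDownFrom suc n)

    |downs| : length (map down downs) ≡ n
    |downs| = trans (length-map down downs) (length-upTo n)

    top : Vec Slice n → Slice
    top U = lastOr empty (reverse U)

    accUp : Vec Slice n → ℕ
    accUp U = finalAcc empty (map up ups) 0 (toList (reverse U))

    +n*Σempty : ∀ x → x + n * sum empty ≡ x
    +n*Σempty x = trans (cong (λ y → x + n * y) (sum-replicate-0 (suc n))) (trans (cong (x +_) (*-zeroʳ n)) (+-identityʳ x))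

    finalAcc-box : (U L : Vec Slice n) → AscendingFrom empty (reverse U) → DescendingFrom (top U) L → lastOr (top U) L ≡ empty →
                   finalAcc (top U) (map down downs) (accUp U) (toList L) ≡ total U + total L
    finalAcc-box U L asc desc end≡empty = begin
      accDown                          ≡⟨ +n*Σempty accDown ⟨
      accDown + n * sum empty          ≡⟨ cong (λ v → accDown + n * sum v) end≡empty ⟨
      accDown + n * sum (lastOr _ L)   ≡⟨ finalAcc-down id (λ _ → refl) (accUp U) L desc ⟩
      accUp U + 0 + total L            ≡⟨ cong (_+ total L) (+-identityʳ (accUp U)) ⟩
      accUp U + total L                ≡⟨ cong (_+ total L) (+n*Σempty (accUp U)) ⟨
      accUp U + n * sum empty + total L ≡⟨ cong (_+ total L) (trans (finalAcc-up 0 (reverse U) asc) (total-reverse U)) ⟩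
      total U + total L                ∎
      where
      open ≡-Reasoning
      accDown = finalAcc (top U) (map down downs) (accUp U) (toList L)

  IsWalk-box⁻ : (U L : Vec Slice n) → IsWalk empty boxWord 0 (toList (reverse U ++ᵥ L)) → Sliced U L × total U + total L ≡ n
  IsWalk-box⁻ U L walk =
    (AscendingFrom-reverse⁻ U asc , subst (λ h → DescendingFrom h L) (lastOr-reverse U) desc ,
     subst (λ h → lastOr h L ≡ empty) (lastOr-reverse U) end≡empty) ,
    trans (sym (finalAcc-box U L asc desc end≡empty)) acc≡n
    where
    split↑ = IsWalk-++⁻ empty (map up ups) (map down downs) 0 (reverse U) (toList L) |ups|
               (subst (IsWalk empty boxWord 0) (toList-++ (reverse U) L) walk)
    split↓ = IsWalk-++⁻ (top U) (map down downs) [] (accUp U) L [] |downs|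
               (subst₂ (λ w βs → IsWalk (top U) w (accUp U) βs) (sym (++-identityʳ _)) (sym (++-identityʳ _)) (proj₂ split↑))
    asc : AscendingFrom empty (reverse U)
    asc = Path-up⁻ ups (reverse U) (proj₁ split↑)
    desc : DescendingFrom (top U) L
    desc = Path-down⁻ downs L (proj₁ split↓)
    end≡empty : lastOr (top U) L ≡ empty
    end≡empty = proj₁ (proj₂ split↓)
    acc≡n : finalAcc (top U) (map down downs) (accUp U) (toList L) ≡ n
    acc≡n = proj₂ (proj₂ split↓)

  IsWalk-box⁺ : (U L : Vec Slice n) → Sliced U L → total U + total L ≡ n → IsWalk empty boxWord 0 (toList (reverse U ++ᵥ L))
  IsWalk-box⁺ U L (desc0 , descL , last≡empty) total≡n = subst (IsWalk empty boxWord 0) (sym (toList-++ (reverse U) L))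
    (IsWalk-++⁺ empty (map up ups) (map down downs) 0 (reverse U) (toList L)
      (Path-up⁺ ups (reverse U) (length-applyDownFrom suc n) asc)
      (subst₂ (λ w βs → IsWalk (top U) w (accUp U) βs) (++-identityʳ _) (++-identityʳ _)
        (IsWalk-++⁺ (top U) (map down downs) [] (accUp U) L [] (Path-down⁺ downs L (length-upTo n) desc)
          (end≡empty , trans (finalAcc-box U L asc desc end≡empty) total≡n))))
    where
    asc : AscendingFrom empty (reverse U)
    asc = AscendingFrom-reverse⁺ U desc0
    desc : DescendingFrom (top U) L
    desc = subst (λ h → DescendingFrom h L) (sym (lastOr-reverse U)) descL
    end≡empty : lastOr (top U) L ≡ empty
    end≡empty = subst (λ h → lastOr h L ≡ empty) (sym (lastOr-reverse U)) last≡empty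

module PlanePartitions (n : ℕ) where

  open import Data.Nat
  open import Data.Nat.Properties using (≤-trans; ≤-reflexive)
  open import Data.List using (List; length)
  open import Data.List.Membership.Propositional using (_∈_)
  open import Data.List.Relation.Unary.Unique.Propositional using (Unique)
  open import Data.Vec using (Vec; toList; reverse; take; drop) renaming (_++_ to _++ᵥ_)
  open import Data.Vec.Properties using (++-injective; take++drop≡id; reverse-involutive)
  import Data.Vec.Relation.Unary.All as All
  open import Data.Product using (_×_; _,_; proj₁; proj₂)
  open import Data.Unit using (⊤; tt)
  open import Function using (_⇔_; Equivalence)
  open import Relation.Nullary using (yes)
  open import Relation.Binary.PropositionalEquality

  open import Defs using (Array; IsPlanePartition)
  open Sums
  open BoundedVectors
  open Slicing
  open Monotonicity
  open Transfer n
  open Walks n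

  toWalk : Array n → Vec Slice (n + n)
  toWalk a = reverse (upper a) ++ᵥ lower a

  fromWalk : Vec Slice (n + n) → Array n
  fromWalk βs = glue (reverse (take n βs)) (drop n βs)

  fromWalk-toWalk : (a : Array n) → fromWalk (toWalk a) ≡ a
  fromWalk-toWalk a = trans (cong₂ glue (trans (cong reverse (proj₁ split)) (reverse-involutive (upper a))) (proj₂ split))
                            (glue-upper-lower a)
    where
    split = ++-injective (take n (toWalk a)) (reverse (upper a)) (take++drop≡id n (toWalk a))

  toWalk-fromWalk : (βs : Vec Slice (n + n)) → Sliced (reverse (take n βs)) (drop n βs) → toWalk (fromWalk βs) ≡ βs
  toWalk-fromWalk βs sliced with upper≡ , lower≡ ← upper-lower-glue _ _ sliced =
    trans (cong₂ (λ U L → reverse U ++ᵥ L) upper≡ lower≡)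
          (trans (cong (_++ᵥ drop n βs) (reverse-involutive (take n βs))) (take++drop≡id n βs))

  toWalk-isWalk : (a : Array n) → IsPlanePartition n a → IsWalk empty boxWord 0 (toList (toWalk a))
  toWalk-isWalk a (total≡n , mono) = IsWalk-box⁺ (upper a) (lower a)
    (Sliced-upper-lower⁺ a (Monotone⇒HookMonotone a mono)) (trans (sym (total-upper-lower a)) total≡n)

  toWalk∈ : (a : Array n) → IsPlanePartition n a → toWalk a ∈ vecsOver slices (n + n)
  toWalk∈ a (total≡n , _) = ∈-vecsOver⁺ (All.map (λ {v} Σv≤ → ∈-vecsUpTo⁺ (sum≤⇒All≤ v (≤-trans Σv≤ total≤n))) (sum≤total (toWalk a)))
    where
    total≤n : total (toWalk a) ≤ n
    total≤n = ≤-reflexive (trans (total-++ (reverse (upper a)) (lower a))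
      (trans (cong (_+ total (lower a)) (total-reverse (upper a))) (trans (sym (total-upper-lower a)) total≡n)))

  fromWalk-isPlanePartition : (βs : Vec Slice (n + n)) → IsWalk empty boxWord 0 (toList βs) →
                              Sliced (reverse (take n βs)) (drop n βs) × IsPlanePartition n (fromWalk βs)
  fromWalk-isPlanePartition βs walk = sliced , total≡n , HookMonotone⇒Monotone (glue U L)
    (Sliced-upper-lower⁻ (glue U L) (subst₂ Sliced (sym (proj₁ glued)) (sym (proj₂ glued)) sliced))
    where
    U = reverse (take n βs)
    L = drop n βs
    βs≡ : reverse U ++ᵥ L ≡ βs
    βs≡ = trans (cong (_++ᵥ L) (reverse-involutive (take n βs))) (take++drop≡id n βs)
    box : Sliced U L × total U + total L ≡ n
    box = IsWalk-box⁻ U L (subst (λ vs → IsWalk empty boxWord 0 (toList vs)) (sym βs≡) walk)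
    sliced : Sliced U L
    sliced = proj₁ box
    glued : upper (glue U L) ≡ U × lower (glue U L) ≡ L
    glued = upper-lower-glue U L sliced
    total≡n : total (glue U L) ≡ n
    total≡n = trans (total-upper-lower (glue U L))
      (trans (cong₂ _+_ (cong total (proj₁ glued)) (cong total (proj₂ glued))) (proj₂ box))

  length≡#walks : (P : List (Array n)) → Unique P → (∀ a → (a ∈ P) ⇔ IsPlanePartition n a) →
                  length P ≡ #walks empty boxWord 0
  length≡#walks P unique-P P⇔ = trans (length≡∑1 P) (trans
    (∑-reindex (λ _ → yes tt) (λ βs → isWalk? empty boxWord 0 (toList βs))
               unique-P (vecsOver-unique (vecsUpTo-unique n (suc n)) (n + n)) toWalk fromWalk to from (λ _ → 1))
    (sym (#walks≡∑ empty boxWord 0 length-boxWord)))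
    where
    to : ∀ {a} → a ∈ P → ⊤ →
         (toWalk a ∈ vecsOver slices (n + n) × IsWalk empty boxWord 0 (toList (toWalk a))) × fromWalk (toWalk a) ≡ a
    to {a} a∈P _ = let pp = Equivalence.to (P⇔ a) a∈P in (toWalk∈ a pp , toWalk-isWalk a pp) , fromWalk-toWalk a
    from : ∀ {βs} → βs ∈ vecsOver slices (n + n) → IsWalk empty boxWord 0 (toList βs) →
           (fromWalk βs ∈ P × ⊤) × toWalk (fromWalk βs) ≡ βs
    from {βs} _ walk = let sliced , pp = fromWalk-isPlanePartition βs walk in
      (Equivalence.from (P⇔ (fromWalk βs)) pp , tt) , toWalk-fromWalk βs sliced

module Formula where

  open import Data.Nat
  open import Data.Nat.Properties
  open import Data.Nat.DivMod using (_/_; m*[n/m]≡n)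
  open import Data.Nat.Divisibility using (_∣_; ∣-trans; ∣-refl; ∣⇒≤; ∣m+n∣m⇒∣n; ∣1⇒≡1)
  open import Data.Nat.LCM using (m∣lcm[m,n]; n∣lcm[m,n]; gcd*lcm)
  open import Data.Nat.GCD using (gcd)
  open import Data.Nat.Combinatorics using (_C_; nCn≡1)
  open import Data.Integer as ℤ using (ℤ; +_)
  import Data.Integer.Properties as ℤ
  open import Data.List using (List; []; _∷_; map; applyUpTo)
  open import Data.List.Membership.Propositional using (_∈_)
  open import Data.List.Relation.Unary.Any using (here; there)
  open import Data.List.Relation.Unary.Unique.Propositional using (Unique)
  open import Data.Fin using (Fin; toℕ)
  open import Data.Vec as Vec using (Vec; []; _∷_; lookup; tabulate)
  open import Data.Vec.Properties using (tabulate-cong)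
  open import Data.Vec.Relation.Unary.All as All using (All; []; _∷_)
  open import Data.Product using (Σ; _×_; _,_; proj₁; proj₂)
  open import Data.Sum using ([_,_]′)
  open import Data.Unit using (⊤; tt)
  open import Function using (_⇔_; Equivalence; _∘′_; id)
  open import Relation.Nullary using (yes; no; ¬_; contradiction)
  open import Relation.Binary.PropositionalEquality

  open import Defs
  open Sums
  open Binomials
  open BoundedVectors

  private variable
    A : Set
    m : ℕ

  ∣D : ∀ m {s} → 1 ≤ s → s ≤ m → s ∣ D m
  ∣D zero    1≤s s≤0   = contradiction (≤-trans 1≤s s≤0) λ ()
  ∣D (suc m) 1≤s s≤1+m = [ (λ s<1+m → ∣-trans (∣D m 1≤s (≤-pred s<1+m)) (n∣lcm[m,n] (suc m) (D m)))
                         , (λ { refl → m∣lcm[m,n] (suc m) (D m) }) ]′ (m≤n⇒m<n∨m≡n s≤1+m)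

  D≢0 : ∀ m → NonZero (D m)
  D≢0 zero    = _
  D≢0 (suc m) = ≢-nonZero λ D≡0 → ≢-nonZero⁻¹ (suc m * D m) {{m*n≢0 (suc m) (D m) {{_}} {{D≢0 m}}}}
    (trans (sym (gcd*lcm (suc m) (D m))) (trans (cong (gcd (suc m) (D m) *_) D≡0) (*-zeroʳ (gcd (suc m) (D m)))))

  -- If D n were n, then n - 1 would divide n, hence 1.
  n<D : ∀ n → 3 ≤ n → n < D n
  n<D n 3≤n = ≰⇒> λ D≤n → 1+n≰n (subst (2 ≤_) (∣1⇒≡1 (d∣1 D≤n)) 2≤d)
    where
    instance _ = >-nonZero (≤-trans (s≤s z≤n) 3≤n)
    d = pred n
    2≤d : 2 ≤ d
    2≤d = pred-mono-≤ 3≤n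
    d∣1 : D n ≤ n → d ∣ 1
    d∣1 D≤n = ∣m+n∣m⇒∣n (subst (d ∣_) D≡d+1 (∣D n (≤-trans (s≤s z≤n) 2≤d) pred[n]≤n)) ∣-refl
      where
      D≡d+1 : D n ≡ d + 1
      D≡d+1 = trans (≤-antisym D≤n (∣⇒≤ {{D≢0 n}} (∣D n (≤-trans (s≤s z≤n) 3≤n) ≤-refl)))
                    (sym (trans (+-comm d 1) (suc-pred n)))

  -- The summand of innerSum is local to its definition; abstracting the i = 0 term and the
  -- remaining indices lets unification name it, so that its other values can be computed.
  private
    innerSum-terms : (Dn s ℓ : ℕ) → Σ (ℕ → ℤ) λ f →
                     innerSum Dn (suc s) ℓ ≡ + 1 ℤ.* + multichoose (suc s) ℓ ℤ.+ sumℤ (map f (applyUpTo suc ℓ))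
    innerSum-terms Dn s ℓ with multichoose (suc s) ℓ | applyUpTo suc ℓ
    ... | _ | _ = _ , refl

    innerTerm≡0 : ∀ Dn s ℓ j → ¬ (j * (Dn / suc s) ≤ ℓ) → proj₁ (innerSum-terms Dn s ℓ) j ≡ + 0
    innerTerm≡0 Dn s ℓ j j*q≰ℓ with j * (Dn / suc s) ≤? ℓ
    ... | yes j*q≤ℓ = contradiction j*q≤ℓ j*q≰ℓ
    ... | no _      = refl

  sumℤ-applyUpTo-zero : (f : ℕ → ℤ) (g : ℕ → ℕ) (m : ℕ) → (∀ k → f (g k) ≡ + 0) → sumℤ (map f (applyUpTo g m)) ≡ + 0
  sumℤ-applyUpTo-zero f g zero    f∘g≡0 = refl
  sumℤ-applyUpTo-zero f g (suc m) f∘g≡0 =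
    cong₂ ℤ._+_ (f∘g≡0 0) (sumℤ-applyUpTo-zero f (g ∘′ suc) m (λ k → f∘g≡0 (suc k)))

  innerSum-small : ∀ Dn s ℓ → ℓ < Dn / suc s → innerSum Dn (suc s) ℓ ≡ + multichoose (suc s) ℓ
  innerSum-small Dn s ℓ ℓ<q = begin
    innerSum Dn (suc s) ℓ                                      ≡⟨ proj₂ (innerSum-terms Dn s ℓ) ⟩
    + 1 ℤ.* + multichoose (suc s) ℓ ℤ.+ sumℤ (map f (applyUpTo suc ℓ))
      ≡⟨ cong₂ ℤ._+_ (ℤ.*-identityˡ (+ multichoose (suc s) ℓ))
                     (sumℤ-applyUpTo-zero f suc ℓ (λ j → innerTerm≡0 Dn s ℓ (suc j) (<⇒≱ (ℓ<[1+j]*q j)))) ⟩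
    + multichoose (suc s) ℓ ℤ.+ + 0                            ≡⟨ ℤ.+-identityʳ _ ⟩
    + multichoose (suc s) ℓ                                    ∎
    where
    open ≡-Reasoning
    f = proj₁ (innerSum-terms Dn s ℓ)
    ℓ<[1+j]*q : ∀ j → ℓ < suc j * (Dn / suc s)
    ℓ<[1+j]*q j = <-≤-trans ℓ<q (m≤m+n (Dn / suc s) (j * (Dn / suc s)))

  m*n<o⇒n<o/m : ∀ m {n o} .{{_ : NonZero m}} → m ∣ o → m * n < o → n < o / m
  m*n<o⇒n<o/m m {n} {o} m∣o m*n<o = *-cancelˡ-< m n (o / m) (subst (m * n <_) (sym (m*[n/m]≡n m∣o)) m*n<o)

  prodFrom-small : ∀ {Dn N} → (∀ {s} → 1 ≤ s → s ≤ N → s ∣ Dn) → N < Dn →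
                   ∀ start (ℓs : Vec ℕ m) → 1 ≤ start → start + m ≤ suc N → weightedSumFrom start ℓs ≤ N →
                   prodFrom Dn start ℓs ≡ + multichooseProduct start ℓs
  prodFrom-small ∣Dn N<Dn start [] _ _ _ = refl
  prodFrom-small {suc m} {Dn} {N} ∣Dn N<Dn (suc s) (x ∷ ℓs) _ fits ws≤N = begin
    innerSum Dn (suc s) x ℤ.* prodFrom Dn (suc (suc s)) ℓs
      ≡⟨ cong₂ ℤ._*_ (innerSum-small Dn s x x<q)
                     (prodFrom-small ∣Dn N<Dn (suc (suc s)) ℓs (s≤s z≤n) fits′ (≤-trans (m≤n+m _ _) ws≤N)) ⟩
    + multichoose (suc s) x ℤ.* + multichooseProduct (suc (suc s)) ℓs
      ≡⟨ ℤ.pos-* (multichoose (suc s) x) (multichooseProduct (suc (suc s)) ℓs) ⟨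
    + multichooseProduct (suc s) (x ∷ ℓs) ∎
    where
    open ≡-Reasoning
    fits′ : suc (suc s) + m ≤ suc N
    fits′ = ≤-trans (≤-reflexive (sym (+-suc (suc s) m))) fits
    s∣Dn : suc s ∣ Dn
    s∣Dn = ∣Dn (s≤s z≤n) (≤-pred (≤-trans (s≤s (m≤m+n (suc s) m)) (≤-trans (≤-reflexive (sym (+-suc (suc s) m))) fits)))
    x<q : x < Dn / suc s
    x<q = m*n<o⇒n<o/m (suc s) s∣Dn (≤-<-trans (≤-trans (m≤m+n (suc s * x) _) ws≤N) N<Dn)

  multichoose-1 : ∀ x → multichoose 1 x ≡ 1
  multichoose-1 x = trans (cong (_C x) (m+n∸n≡m x 1)) (nCn≡1 x)

  summand-small : ∀ n → 3 ≤ n → (ℓ : Vec ℕ n) → weightedSumFrom 1 ℓ ≡ n → summand n ℓ ≡ + multichooseProduct 1 ℓ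
  summand-small (suc n) 3≤n (x ∷ ℓ) ws≡n = trans
    (prodFrom-small (∣D (suc n)) (n<D (suc n) 3≤n) 2 ℓ (s≤s z≤n) ≤-refl (≤-trans (m≤n+m _ (1 * x)) (≤-reflexive ws≡n)))
    (cong +_ (sym (trans (cong (_* multichooseProduct 2 ℓ) (multichoose-1 x)) (*-identityˡ _))))

  weightedSum≡weightedSumFrom : (ℓ : Vec ℕ m) → weightedSum ℓ ≡ weightedSumFrom 1 ℓ
  weightedSum≡weightedSumFrom = shifted 0
    where
    shifted : ∀ {m} c (ℓ : Vec ℕ m) →
              Vec.sum (tabulate (λ (k : Fin m) → (c + suc (toℕ k)) * lookup ℓ k)) ≡ weightedSumFrom (suc c) ℓ
    shifted c []      = refl
    shifted c (x ∷ ℓ) = cong₂ _+_ (cong (_* x) (+-comm c 1))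
      (trans (cong Vec.sum (tabulate-cong (λ k → cong (_* lookup ℓ k) (+-suc c (suc (toℕ k)))))) (shifted (suc c) ℓ))

  sumℤ-cong : (xs : List A) {f g : A → ℤ} → (∀ {x} → x ∈ xs → f x ≡ g x) → sumℤ (map f xs) ≡ sumℤ (map g xs)
  sumℤ-cong []       f≡g = refl
  sumℤ-cong (x ∷ xs) f≡g = cong₂ ℤ._+_ (f≡g (here refl)) (sumℤ-cong xs (f≡g ∘′ there))

  sumℤ-+ : (xs : List A) (f : A → ℕ) → sumℤ (map (λ x → + f x) xs) ≡ + ∑ xs f
  sumℤ-+ []       f = refl
  sumℤ-+ (x ∷ xs) f = trans (cong (ℤ._+_ (+ f x)) (sumℤ-+ xs f)) (sym (ℤ.pos-+ (f x) (∑ xs f)))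

  sumℤ-summand : ∀ n → 3 ≤ n → (A : List (Vec ℕ n)) → Unique A → (∀ ℓ → (ℓ ∈ A) ⇔ InA n ℓ) →
              sumℤ (map (summand n) A) ≡ + (∑[ v ← vecsUpTo n n ] multichooseProduct 1 v * ([ weightedSumFrom 1 v ≟ n ]· 1))
  sumℤ-summand n 3≤n A unique-A A⇔ = begin
    sumℤ (map (summand n) A)                       ≡⟨ sumℤ-cong A (λ {ℓ} ℓ∈A → summand-small n 3≤n ℓ (ws≡n ℓ∈A)) ⟩
    sumℤ (map (λ ℓ → + multichooseProduct 1 ℓ) A)  ≡⟨ sumℤ-+ A (multichooseProduct 1) ⟩
    + ∑ A (multichooseProduct 1)
      ≡⟨ cong +_ (∑-reindex (λ _ → yes tt) (λ v → weightedSumFrom 1 v ≟ n) unique-A (vecsUpTo-unique n n)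
                   id id to from (multichooseProduct 1)) ⟩
    + (∑[ v ← vecsUpTo n n ] [ weightedSumFrom 1 v ≟ n ]· multichooseProduct 1 v)
      ≡⟨ cong +_ (∑-cong (vecsUpTo n n) (λ v → []·≡*[]·1 (weightedSumFrom 1 v ≟ n) _)) ⟩
    + (∑[ v ← vecsUpTo n n ] multichooseProduct 1 v * ([ weightedSumFrom 1 v ≟ n ]· 1)) ∎
    where
    open ≡-Reasoning
    ws≡n : ∀ {ℓ} → ℓ ∈ A → weightedSumFrom 1 ℓ ≡ n
    ws≡n {ℓ} ℓ∈A = trans (sym (weightedSum≡weightedSumFrom ℓ)) (Equivalence.to (A⇔ ℓ) ℓ∈A)
    to : ∀ {ℓ} → ℓ ∈ A → ⊤ → (ℓ ∈ vecsUpTo n n × weightedSumFrom 1 ℓ ≡ n) × ℓ ≡ ℓ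
    to {ℓ} ℓ∈A _ = (∈-vecsUpTo⁺ (subst (λ N → All (_≤ N) ℓ) (ws≡n ℓ∈A) (weightedSumFrom-All≤ (s≤s z≤n) ℓ)) , ws≡n ℓ∈A) , refl
    from : ∀ {v} → v ∈ vecsUpTo n n → weightedSumFrom 1 v ≡ n → (v ∈ A × ⊤) × v ≡ v
    from {v} _ ws≡n = (Equivalence.from (A⇔ v) (trans (weightedSum≡weightedSumFrom v) ws≡n) , tt) , refl

open import Defs
open import Data.Nat using (ℕ; _≤_; _*_; _≟_; suc; s≤s; z≤n)
open import Data.Nat.Properties using (<-irrefl)
open import Data.Integer using (+_)
open import Data.Vec using (Vec)
open import Data.List using (List; length; map; upTo; applyDownFrom)
open import Data.List.Membership.Propositional using (_∈_)
open import Data.List.Relation.Unary.All.Properties using (applyDownFrom⁺₁)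
open import Data.List.Relation.Unary.Unique.Propositional using (Unique)
open import Function.Bundles using (_⇔_)
open import Relation.Binary.PropositionalEquality using (_≡_; sym; trans; cong; module ≡-Reasoning)

open Sums
open Binomials
open BoundedVectors
open Formula

length-planePartitions : ∀ n (P : List (Array n)) → Unique P → (∀ a → (a ∈ P) ⇔ IsPlanePartition n a) →
                        length P ≡ ∑[ v ← vecsUpTo n n ] multichooseProduct 1 v * ([ weightedSumFrom 1 v ≟ n ]· 1)
length-planePartitions n P unique-P P⇔ = begin
  length P
    ≡⟨ length≡#walks P unique-P P⇔ ⟩
  #walks empty boxWord 0
    ≡⟨ #walks-up-down (applyDownFrom suc n) (upTo n) (applyDownFrom⁺₁ suc n (λ _ → s≤s z≤n)) ⟩
  withParts hooks isN 0
    ≡⟨ withParts-hooks isN↓ ⟩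
  withParts (blocks 1 n) isN 0
    ≡⟨ withParts-blocks n 1 isN 0 (s≤s z≤n) isN↓ ⟩
  ∑[ v ← vecsUpTo n n ] multichooseProduct 1 v * isN (weightedSumFrom 1 v) ∎
  where
  open ≡-Reasoning
  open Parts n
  open Transfer n
  open PlanePartitions n
  open Walks n using (boxWord)
  isN : ℕ → ℕ
  isN x = [ x ≟ n ]· 1
  isN↓ : Vanishing isN
  isN↓ {x} n<x = []·-no (x ≟ n) (λ x≡n → <-irrefl (sym x≡n) n<x) 1

theorem2p2 : (n : ℕ) → 3 ≤ n →
    (P : List (Array n)) → Unique P → (∀ a → (a ∈ P) ⇔ IsPlanePartition n a) →
    (A : List (Vec ℕ n)) → Unique A → (∀ ℓ → (ℓ ∈ A) ⇔ InA n ℓ) →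
    + (length P) ≡ sumℤ (map (summand n) A)
theorem2p2 n 3≤n P unique-P P⇔ A unique-A A⇔ =
  trans (cong +_ (length-planePartitions n P unique-P P⇔)) (sym (sumℤ-summand n 3≤n A unique-A A⇔))
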